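{- For $n\ge1$ and positive weights $a,b,c$, let $\Phi_n^{I},\Phi_n^{II},\Phi_n^{III},\Phi_n^{IV}$ be the partition functions of dimer coverings of types I, II, III, IV of the Schreier graph $\Sigma_n$ of the Hanoi Towers group $H^{(3)}$. Then for every $n\ge1$, $$\begin{cases}\Phi_{n+1}^{I}=(\Phi_n^{I})^3\frac{1}{abc}+\Phi_n^{II}\Phi_n^{III}\Phi_n^{IV},\\ \Phi_{n+1}^{II}=(\Phi_n^{II})^3\frac1c+\Phi_n^{I}\Phi_n^{III}\Phi_n^{IV}\frac1{ab},\\ \Phi_{n+1}^{III}=(\Phi_n^{III})^3\frac1b+\Phi_n^{I}\Phi_n^{II}\Phi_n^{IV}\frac1{ac},\\ \Phi_{n+1}^{IV}=(\Phi_n^{IV})^3\frac1a+\Phi_n^{I}\Phi_n^{II}\Phi_n^{III}\frac1{bc},\end{cases}$$ with initial conditions $$\Phi_1^{I}=abc,\qquad \Phi_1^{II}=c^2,\qquad \Phi_1^{III}=b^2,\qquad \Phi_1^{IV}=a^2.$$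
   Context: The Hanoi Towers group $H^{(3)}$ is generated by the involutions $a,b,c$ acting on ternary words (over $\{0,1,2\}$), defined recursively for any ternary word $w$ by - $a(0w)=1w$, $a(1w)=0w$, $a(2w)=2a(w)$; - $b(0w)=2w$, $b(2w)=0w$, $b(1w)=1b(w)$; - $c(1w)=2w$, $c(2w)=1w$, $c(0w)=0c(w)$. The Schreier graph $\Sigma_n$ has vertex set $\{0,1,2\}^n$. For each $s\in\{a,b,c\}$ and each unordered pair $\{u,s(u)\}$ with $s(u)\ne u$, it has one edge labeled $s$. In addition it has one loop labeled $s$ at each fixed point of $s$; these are exactly a loop labeled $c$ at $0^n$, a loop labeled $b$ at $1^n$, and a loop labeled $a$ at $2^n$. A dimer covering of $\Sigma_n$ is a set of edges, loops allowed, such that every vertex lies on exactly one of them; a loop covers its single vertex. Since $3^n$ is odd, such a covering contains one or three loops. A covering is of - type I if it contains all three loops; - type II if it contains only the loop at $0^n$; - type III if it contains only the loop at $1^n$; - type IV if it contains only the loop at $2^n$. With positive weights $a,b,c$ assigned to edges (and loops) according to their label, the weight of a covering is the product of the weights of its elements, and $\Phi_n^{i}$ is the sum of the weights of the coverings of type $i$.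
   Formalization: The weights $a,b,c$ range over the positive rationals. -}

module Defs where

open import Data.Nat using (ℕ; zero; suc; _<ᵇ_; _≡ᵇ_)
open import Data.Fin using (Fin; zero; suc; toℕ)
open import Data.Vec using (Vec; []; _∷_; replicate)
open import Data.List using (List; []; _∷_; _++_; map; concatMap; filter; foldr; length)
open import Data.Bool using (Bool; true; false; _∧_; _∨_; not; if_then_else_)
open import Data.Product using (_×_; _,_; proj₁; proj₂)
open import Data.Rational using (ℚ; 0ℚ; 1ℚ; _+_; _*_; _<_; _>_; 1/_; >-nonZero)
open import Relation.Nullary using (Dec; yes; no; ⌊_⌋)
open import Relation.Binary.PropositionalEquality using (_≡_)
import Data.Vec.Properties as VP
import Data.Fin.Properties as FP

Letter : Set
Letter = Fin 3

pattern l0 = zero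
pattern l1 = suc zero
pattern l2 = suc (suc zero)

-- Vertices of Σ_n : ternary words of length n
Word : ℕ → Set
Word n = Vec Letter n

data Gen : Set where
  ga gb gc : Gen

act : Gen → ∀ {n} → Word n → Word n
act _  []        = []
act ga (l0 ∷ w)  = l1 ∷ w
act ga (l1 ∷ w)  = l0 ∷ w
act ga (l2 ∷ w)  = l2 ∷ act ga w
act gb (l0 ∷ w)  = l2 ∷ w
act gb (l2 ∷ w)  = l0 ∷ w
act gb (l1 ∷ w)  = l1 ∷ act gb w
act gc (l1 ∷ w)  = l2 ∷ w
act gc (l2 ∷ w)  = l1 ∷ w
act gc (l0 ∷ w)  = l0 ∷ act gc w

_≟w_ : ∀ {n} (u v : Word n) → Dec (u ≡ v)
_≟w_ = VP.≡-dec FP._≟_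

-- strict lexicographic order on words (Boolean), used only to pick one
-- representative of each unordered pair {u, s(u)}
_<lex_ : ∀ {n} → Word n → Word n → Bool
[]      <lex []      = false
(x ∷ u) <lex (y ∷ v) =
  if ⌊ x FP.≟ y ⌋ then u <lex v else (toℕ x <ᵇ toℕ y)

_==w_ : ∀ {n} → Word n → Word n → Bool
u ==w v = ⌊ u ≟w v ⌋

_==g_ : Gen → Gen → Bool
ga ==g ga = true
gb ==g gb = true
gc ==g gc = true
_  ==g _  = false

allWords : ∀ n → List (Word n)
allWords zero    = [] ∷ []
allWords (suc n) = concatMap (λ x → map (x ∷_) (allWords n)) (l0 ∷ l1 ∷ l2 ∷ [])

bfilter : ∀ {A : Set} → (A → Bool) → List A → List A
bfilter p []       = []
bfilter p (x ∷ xs) = if p x then x ∷ bfilter p xs else bfilter p xs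

-- An edge (or loop) of Σ_n: a label s together with the lexicographically
-- smaller endpoint u of the unordered pair {u, s(u)} (u = s(u) for a loop).
Edge : ℕ → Set
Edge n = Gen × Word n

label : ∀ {n} → Edge n → Gen
label = proj₁

-- the edge set of Σ_n: exactly one element per label s and unordered pair
-- {u, s(u)}, including one loop per fixed point of s
edges : ∀ n → List (Edge n)
edges n = concatMap (λ s → map (s ,_) (bfilter (λ u → not (act s u <lex u)) (allWords n)))
                    (ga ∷ gb ∷ gc ∷ [])

incident : ∀ {n} → Edge n → Word n → Bool
incident (s , u) v = (u ==w v) ∨ (act s u ==w v)

count : ∀ {A : Set} → (A → Bool) → List A → ℕ
count p []       = 0
count p (x ∷ xs) = if p x then suc (count p xs) else count p xs

allB : ∀ {A : Set} → (A → Bool) → List A → Bool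
allB p []       = true
allB p (x ∷ xs) = p x ∧ allB p xs

anyB : ∀ {A : Set} → (A → Bool) → List A → Bool
anyB p []       = false
anyB p (x ∷ xs) = p x ∨ anyB p xs

subsets : ∀ {A : Set} → List A → List (List A)
subsets []       = [] ∷ []
subsets (x ∷ xs) = let r = subsets xs in map (x ∷_) r ++ r

isDimer : ∀ {n} → List (Edge n) → Bool
isDimer {n} C = allB (λ v → count (λ e → incident e v) C ≡ᵇ 1) (allWords n)

_==e_ : ∀ {n} → Edge n → Edge n → Bool
(s , u) ==e (t , v) = (s ==g t) ∧ (u ==w v)

memE : ∀ {n} → Edge n → List (Edge n) → Bool
memE e C = anyB (e ==e_) C

loop0 loop1 loop2 : ∀ n → Edge n
loop0 n = gc , replicate n l0
loop1 n = gb , replicate n l1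
loop2 n = ga , replicate n l2

data CovType : Set where
  I II III IV : CovType

hasType : ∀ {n} → CovType → List (Edge n) → Bool
hasType {n} I   C = memE (loop0 n) C ∧ memE (loop1 n) C ∧ memE (loop2 n) C
hasType {n} II  C = memE (loop0 n) C ∧ not (memE (loop1 n) C) ∧ not (memE (loop2 n) C)
hasType {n} III C = not (memE (loop0 n) C) ∧ memE (loop1 n) C ∧ not (memE (loop2 n) C)
hasType {n} IV  C = not (memE (loop0 n) C) ∧ not (memE (loop1 n) C) ∧ memE (loop2 n) C

wt : ℚ → ℚ → ℚ → Gen → ℚ
wt a b c ga = a
wt a b c gb = b
wt a b c gc = c

weight : ∀ {n} → ℚ → ℚ → ℚ → List (Edge n) → ℚ
weight a b c C = foldr (λ e r → wt a b c (label e) * r) 1ℚ C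

Φ : CovType → (a b c : ℚ) → ℕ → ℚ
Φ i a b c n =
  foldr _+_ 0ℚ (map (weight a b c)
    (bfilter (λ C → isDimer C ∧ hasType i C) (subsets (edges n))))

inv : (p : ℚ) → p > 0ℚ → ℚ
inv p h = 1/_ p {{>-nonZero h}}

module Submission where

-- The argument works with a generalised partition function Z E r: the weighted sum over the
-- sub-collections of an edge list E that cover every vertex v exactly r v times (a dimer covering is
-- the case r = 1).  Z satisfies a deletion recursion (Z-cons), does not depend on the order of E
-- (Z-perm), factorises over three vertex-disjoint copies of a graph (Z-copies), and vanishes on a
-- loopless graph whenever the total demand Σ_v r v is odd (Z-odd).
-- The edges of Σ_n are its three loops, at the corners 0^n, 1^n, 2^n, and its inner edges
-- (edges-loops); the inner edges of Σ_(n+1) are three bridges together with three copies of the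
-- inner edges of Σ_n, the copies being the words ending in 0, 1, 2 (inner-suc).
-- Splitting a covering according to its loops writes Φ^i_n as a loop weight times a reduced
-- partition function F z n = Z (inner n) (req z), where z records the loops used (Φ-I .. Φ-IV).
-- Splitting according to the bridges writes F at level n+1 as a sum over the eight sets of bridges of
-- products of three F's at level n (F-suc); by parity only two of the eight terms survive
-- (F-rec-I .. F-rec-IV).  Multiplying back by the loop weights gives the theorem; the initial
-- values are evaluated directly on Σ_1.

open import Defs
open import Data.Nat as ℕ using (ℕ; zero; suc; _∸_; _≡ᵇ_; _<ᵇ_)
import Data.Nat.Properties as ℕₚ
open import Data.Fin using (toℕ; #_)
import Data.Fin.Properties as Fin
open import Data.Vec using ([]; _∷_; replicate; _∷ʳ_; initLast)
open import Data.Bool using (Bool; true; false; _∧_; _∨_; not; if_then_else_; _xor_)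
open import Data.Bool.Properties using (∧-assoc; ∧-zeroʳ; ∧-identityʳ; ∧-distribʳ-∨; ∨-identityʳ; ∨-assoc; ∨-comm)
open import Data.List using (List; []; _∷_; _++_; map; foldr; length; [_])
import Data.List.Properties as List
open import Data.List.Relation.Unary.All using (All; []; _∷_) renaming (map to All-map)
import Data.List.Relation.Unary.All.Properties as AllP
open import Data.List.Relation.Binary.Permutation.Propositional using (_↭_; refl; prep; swap; trans; ↭-reflexive)
open import Data.List.Relation.Binary.Permutation.Propositional.Properties using (++-commutativeMonoid; ++⁺; map⁺)
open import Data.Product using (_×_; _,_; proj₁; proj₂; ∃₂)
open import Data.Empty using (⊥-elim)
open import Data.Maybe using (nothing)
open import Relation.Nullary using (Dec; yes; no; ⌊_⌋)
open import Relation.Binary.PropositionalEquality using (_≡_; _≢_; refl; sym; cong; cong₂; subst; module ≡-Reasoning)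
  renaming (trans to ≡-trans)
open import Data.Rational using (ℚ; 0ℚ; 1ℚ; _+_; _*_; _>_; >-nonZero)
open import Data.Rational.Properties using (+-identityˡ; +-identityʳ; +-assoc; *-assoc; *-comm; *-zeroˡ; *-zeroʳ;
  *-identityˡ; *-identityʳ; *-inverseʳ; *-distribˡ-+; +-*-commutativeRing; +-0-commutativeMonoid)
open import Algebra.Bundles using (CommutativeMonoid)
open import Algebra.Properties.CommutativeSemigroup (CommutativeMonoid.commutativeSemigroup +-0-commutativeMonoid)
  using (interchange)
open import Tactic.RingSolver using (solve-∀)
open import Tactic.RingSolver.Core.AlmostCommutativeRing using (AlmostCommutativeRing; fromCommutativeRing)
open import Level using (0ℓ)


sumℚ : List ℚ → ℚ
sumℚ = foldr _+_ 0ℚ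

sumℚ-++ : ∀ xs ys → sumℚ (xs ++ ys) ≡ sumℚ xs + sumℚ ys
sumℚ-++ []       ys = sym (+-identityˡ _)
sumℚ-++ (x ∷ xs) ys = ≡-trans (cong (x +_) (sumℚ-++ xs ys)) (sym (+-assoc x _ _))

sumℚ-bfilter : ∀ {A : Set} (w : A → ℚ) (p : A → Bool) L →
  sumℚ (map w (bfilter p L)) ≡ sumℚ (map (λ C → if p C then w C else 0ℚ) L)
sumℚ-bfilter w p [] = refl
sumℚ-bfilter w p (x ∷ L) with p x
... | true  = cong (w x +_) (sumℚ-bfilter w p L)
... | false = ≡-trans (sumℚ-bfilter w p L) (sym (+-identityˡ _))

module _ {A : Set} where

  Σsub : (List A → ℚ) → List A → ℚ
  Σsub f E = sumℚ (map f (subsets E))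

  Σsub-cons : ∀ (f : List A → ℚ) x E → Σsub f (x ∷ E) ≡ Σsub (λ C → f (x ∷ C)) E + Σsub f E
  Σsub-cons f x E = begin
    sumℚ (map f (map (x ∷_) (subsets E) ++ subsets E))
      ≡⟨ cong sumℚ (List.map-++ f (map (x ∷_) (subsets E)) (subsets E)) ⟩
    sumℚ (map f (map (x ∷_) (subsets E)) ++ map f (subsets E))
      ≡⟨ sumℚ-++ (map f (map (x ∷_) (subsets E))) _ ⟩
    sumℚ (map f (map (x ∷_) (subsets E))) + Σsub f E
      ≡⟨ cong (λ l → sumℚ l + Σsub f E) (sym (List.map-∘ (subsets E))) ⟩
    Σsub (λ C → f (x ∷ C)) E + Σsub f E ∎
    where open ≡-Reasoning

  Σsub-cong : ∀ {f g : List A → ℚ} → (∀ C → f C ≡ g C) → ∀ E → Σsub f E ≡ Σsub g E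
  Σsub-cong h E = cong sumℚ (List.map-cong h (subsets E))

  Σsub-congᴬ : ∀ (P : A → Set) {f g : List A → ℚ} E → All P E →
    (∀ C → All P C → f C ≡ g C) → Σsub f E ≡ Σsub g E
  Σsub-congᴬ P []      []         h = cong (_+ 0ℚ) (h [] [])
  Σsub-congᴬ P {f} {g} (x ∷ E) (px ∷ pE) h = begin
    Σsub f (x ∷ E)                             ≡⟨ Σsub-cons f x E ⟩
    Σsub (λ C → f (x ∷ C)) E + Σsub f E        ≡⟨ cong₂ _+_ (Σsub-congᴬ P E pE (λ C pC → h (x ∷ C) (px ∷ pC)))
                                                             (Σsub-congᴬ P E pE h) ⟩
    Σsub (λ C → g (x ∷ C)) E + Σsub g E        ≡⟨ sym (Σsub-cons g x E) ⟩
    Σsub g (x ∷ E)                             ∎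
    where open ≡-Reasoning

  Σsub-zero : ∀ E → Σsub (λ _ → 0ℚ) E ≡ 0ℚ
  Σsub-zero []      = refl
  Σsub-zero (x ∷ E) = ≡-trans (Σsub-cons _ x E) (cong₂ _+_ (Σsub-zero E) (Σsub-zero E))

  Σsub-scale : ∀ k (f : List A → ℚ) E → Σsub (λ C → k * f C) E ≡ k * Σsub f E
  Σsub-scale k f []      = ≡-trans (+-identityʳ _) (cong (k *_) (sym (+-identityʳ _)))
  Σsub-scale k f (x ∷ E) = begin
    Σsub (λ C → k * f C) (x ∷ E)
      ≡⟨ Σsub-cons _ x E ⟩
    Σsub (λ C → k * f (x ∷ C)) E + Σsub (λ C → k * f C) E
      ≡⟨ cong₂ _+_ (Σsub-scale k _ E) (Σsub-scale k f E) ⟩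
    k * Σsub (λ C → f (x ∷ C)) E + k * Σsub f E
      ≡⟨ sym (*-distribˡ-+ k _ _) ⟩
    k * (Σsub (λ C → f (x ∷ C)) E + Σsub f E)
      ≡⟨ cong (k *_) (sym (Σsub-cons f x E)) ⟩
    k * Σsub f (x ∷ E) ∎
    where open ≡-Reasoning

  PermInvariant : (List A → ℚ) → Set
  PermInvariant f = ∀ {C C'} → C ↭ C' → f C ≡ f C'

  Σsub-perm : ∀ (f : List A → ℚ) → PermInvariant f → ∀ {E E'} → E ↭ E' → Σsub f E ≡ Σsub f E'
  Σsub-perm f inv refl = refl
  Σsub-perm f inv {x ∷ E} {.x ∷ E'} (prep x p) = begin
    Σsub f (x ∷ E)                           ≡⟨ Σsub-cons f x E ⟩
    Σsub (λ C → f (x ∷ C)) E + Σsub f E      ≡⟨ cong₂ _+_ (Σsub-perm _ (λ q → inv (prep x q)) p) (Σsub-perm f inv p) ⟩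
    Σsub (λ C → f (x ∷ C)) E' + Σsub f E'    ≡⟨ sym (Σsub-cons f x E') ⟩
    Σsub f (x ∷ E')                          ∎
    where open ≡-Reasoning
  Σsub-perm f inv {x ∷ y ∷ E} {.y ∷ .x ∷ E'} (swap x y p) = begin
    Σsub f (x ∷ y ∷ E)
      ≡⟨ expand x y E ⟩
    (Σsub (λ C → f (x ∷ y ∷ C)) E + Σsub (λ C → f (x ∷ C)) E) + (Σsub (λ C → f (y ∷ C)) E + Σsub f E)
      ≡⟨ cong₂ _+_ (cong₂ _+_ xy (sub x)) (cong₂ _+_ (sub y) (Σsub-perm f inv p)) ⟩
    (Σsub (λ C → f (y ∷ x ∷ C)) E' + Σsub (λ C → f (x ∷ C)) E') + (Σsub (λ C → f (y ∷ C)) E' + Σsub f E')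
      ≡⟨ interchange (Σsub (λ C → f (y ∷ x ∷ C)) E') (Σsub (λ C → f (x ∷ C)) E') (Σsub (λ C → f (y ∷ C)) E') (Σsub f E') ⟩
    (Σsub (λ C → f (y ∷ x ∷ C)) E' + Σsub (λ C → f (y ∷ C)) E') + (Σsub (λ C → f (x ∷ C)) E' + Σsub f E')
      ≡⟨ sym (expand y x E') ⟩
    Σsub f (y ∷ x ∷ E') ∎
    where
    open ≡-Reasoning
    expand : ∀ u v D → Σsub f (u ∷ v ∷ D) ≡
      (Σsub (λ C → f (u ∷ v ∷ C)) D + Σsub (λ C → f (u ∷ C)) D) + (Σsub (λ C → f (v ∷ C)) D + Σsub f D)
    expand u v D = ≡-trans (Σsub-cons f u (v ∷ D)) (cong₂ _+_ (Σsub-cons _ v D) (Σsub-cons f v D))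
    sub : ∀ u → Σsub (λ C → f (u ∷ C)) E ≡ Σsub (λ C → f (u ∷ C)) E'
    sub u = Σsub-perm _ (λ q → inv (prep u q)) p
    xy : Σsub (λ C → f (x ∷ y ∷ C)) E ≡ Σsub (λ C → f (y ∷ x ∷ C)) E'
    xy = ≡-trans (Σsub-perm _ (λ q → inv (prep x (prep y q))) p) (Σsub-cong (λ C → inv (swap x y refl)) E')
  Σsub-perm f inv (trans p q) = ≡-trans (Σsub-perm f inv p) (Σsub-perm f inv q)

-- Boolean equality of letters and of words, computing by structural recursion
eqL : Letter → Letter → Bool
eqL l0 l0 = true
eqL l1 l1 = true
eqL l2 l2 = true
eqL l0 l1 = false
eqL l0 l2 = false
eqL l1 l0 = false
eqL l1 l2 = false
eqL l2 l0 = false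
eqL l2 l1 = false

eqL-refl : ∀ x → eqL x x ≡ true
eqL-refl l0 = refl
eqL-refl l1 = refl
eqL-refl l2 = refl

eqL-sound : ∀ x y → eqL x y ≡ true → x ≡ y
eqL-sound l0 l0 _ = refl
eqL-sound l1 l1 _ = refl
eqL-sound l2 l2 _ = refl
eqL-sound l0 l1 ()
eqL-sound l0 l2 ()
eqL-sound l1 l0 ()
eqL-sound l1 l2 ()
eqL-sound l2 l0 ()
eqL-sound l2 l1 ()

eqL-≢ : ∀ x y → y ≢ x → eqL x y ≡ false
eqL-≢ x y y≢x with eqL x y in e
... | true  = ⊥-elim (y≢x (sym (eqL-sound x y e)))
... | false = refl

∧-true₁ : ∀ {a b} → a ∧ b ≡ true → a ≡ true
∧-true₁ {true} _ = refl

∧-true₂ : ∀ {a b} → a ∧ b ≡ true → b ≡ true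
∧-true₂ {true} e = e

false≢true : false ≢ true
false≢true ()

eqW : ∀ {n} → Word n → Word n → Bool
eqW []      []      = true
eqW (x ∷ u) (y ∷ v) = eqL x y ∧ eqW u v

eqW-refl : ∀ {n} (u : Word n) → eqW u u ≡ true
eqW-refl []      = refl
eqW-refl (x ∷ u) rewrite eqL-refl x = eqW-refl u

eqW-sound : ∀ {n} (u v : Word n) → eqW u v ≡ true → u ≡ v
eqW-sound []      []      _ = refl
eqW-sound (x ∷ u) (y ∷ v) e = cong₂ _∷_ (eqL-sound x y (∧-true₁ e)) (eqW-sound u v (∧-true₂ {eqL x y} e))

eqW-≢ : ∀ {n} (u v : Word n) → u ≢ v → eqW u v ≡ false
eqW-≢ u v u≢v with eqW u v in e
... | true  = ⊥-elim (u≢v (eqW-sound u v e))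
... | false = refl

eqW-sym : ∀ {n} (u v : Word n) → eqW u v ≡ eqW v u
eqW-sym u v with eqW u v in e
... | true rewrite eqW-sound u v e = sym (eqW-refl v)
... | false with eqW v u in e'
...   | true rewrite eqW-sound v u e' = ⊥-elim (false≢true (≡-trans (sym e) (eqW-refl u)))
...   | false = refl

==w-eqW : ∀ {n} (u v : Word n) → (u ==w v) ≡ eqW u v
==w-eqW u v = agree (u ≟w v)
  where
  agree : (d : Dec (u ≡ v)) → ⌊ d ⌋ ≡ eqW u v
  agree (yes refl) = sym (eqW-refl u)
  agree (no u≢v)   = sym (eqW-≢ u v u≢v)

-- appending a letter at the end of a word: the copy of Σ_n inside Σ_(n+1) indexed by the last letter
eqW-∷ʳ : ∀ {n} x y (u v : Word n) → eqW (u ∷ʳ x) (v ∷ʳ y) ≡ eqW u v ∧ eqL x y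
eqW-∷ʳ x y []      []      with eqL x y
... | true  = refl
... | false = refl
eqW-∷ʳ x y (p ∷ u) (q ∷ v) rewrite eqW-∷ʳ x y u v = sym (∧-assoc (eqL p q) (eqW u v) (eqL x y))

replicate-∷ʳ : ∀ n (x : Letter) → replicate n x ∷ʳ x ≡ replicate (suc n) x
replicate-∷ʳ zero    x = refl
replicate-∷ʳ (suc n) x = cong (x ∷_) (replicate-∷ʳ n x)

eqW-replicate-∷ʳ : ∀ n k y (u : Word n) → eqW (replicate (suc n) k) (u ∷ʳ y) ≡ eqW (replicate n k) u ∧ eqL k y
eqW-replicate-∷ʳ n k y u = ≡-trans (cong (λ t → eqW t (u ∷ʳ y)) (sym (replicate-∷ʳ n k))) (eqW-∷ʳ k y (replicate n k) u)

count-++ : ∀ {A : Set} (p : A → Bool) xs ys → count p (xs ++ ys) ≡ count p xs ℕ.+ count p ys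
count-++ p []       ys = refl
count-++ p (x ∷ xs) ys with p x
... | true  = cong suc (count-++ p xs ys)
... | false = count-++ p xs ys

count-map : ∀ {A B : Set} (p : A → Bool) (f : B → A) xs → count p (map f xs) ≡ count (λ x → p (f x)) xs
count-map p f []       = refl
count-map p f (x ∷ xs) with p (f x)
... | true  = cong suc (count-map p f xs)
... | false = count-map p f xs

count-cong : ∀ {A : Set} {p q : A → Bool} → (∀ x → p x ≡ q x) → ∀ xs → count p xs ≡ count q xs
count-cong h [] = refl
count-cong {p = p} {q} h (x ∷ xs) rewrite h x with q x
... | true  = cong suc (count-cong h xs)
... | false = count-cong h xs

count-false : ∀ {A : Set} (xs : List A) → count (λ _ → false) xs ≡ 0
count-false []       = refl
count-false (x ∷ xs) = count-false xs

count-allWords : ∀ {n} (p : Word (suc n) → Bool) → count p (allWords (suc n)) ≡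
  count (λ u → p (l0 ∷ u)) (allWords n) ℕ.+ (count (λ u → p (l1 ∷ u)) (allWords n)
    ℕ.+ (count (λ u → p (l2 ∷ u)) (allWords n) ℕ.+ 0))
count-allWords {n} p =
  ≡-trans (count-++ p (map (l0 ∷_) W) _) (cong₂ ℕ._+_ (count-map p _ W)
  (≡-trans (count-++ p (map (l1 ∷_) W) _) (cong₂ ℕ._+_ (count-map p _ W)
  (≡-trans (count-++ p (map (l2 ∷_) W) _) (cong₂ ℕ._+_ (count-map p _ W) refl)))))
  where
    W : List (Word n)
    W = allWords n

allWords-unique : ∀ n (v : Word n) → count (λ u → eqW u v) (allWords n) ≡ 1
allWords-unique zero    []       = refl
allWords-unique (suc n) (l0 ∷ v) rewrite count-allWords {n} (λ u → eqW u (l0 ∷ v))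
  | allWords-unique n v | count-false (allWords n) = refl
allWords-unique (suc n) (l1 ∷ v) rewrite count-allWords {n} (λ u → eqW u (l1 ∷ v))
  | allWords-unique n v | count-false (allWords n) = refl
allWords-unique (suc n) (l2 ∷ v) rewrite count-allWords {n} (λ u → eqW u (l2 ∷ v))
  | allWords-unique n v | count-false (allWords n) = refl

allWords-unique′ : ∀ {n} (u : Word n) → count (λ v → eqW u v) (allWords n) ≡ 1
allWords-unique′ {n} u = ≡-trans (count-cong (λ v → eqW-sym u v) (allWords n)) (allWords-unique n u)

allB-intro : ∀ {A : Set} (p : A → Bool) L → (∀ v → p v ≡ true) → allB p L ≡ true
allB-intro p []      h = refl
allB-intro p (x ∷ L) h rewrite h x = allB-intro p L h

allB-ext : ∀ {A : Set} {p q : A → Bool} → (∀ v → p v ≡ q v) → ∀ L → allB p L ≡ allB q L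
allB-ext h []      = refl
allB-ext h (x ∷ L) = cong₂ _∧_ (h x) (allB-ext h L)

allB-∧ : ∀ {A : Set} (p q : A → Bool) L → allB (λ v → p v ∧ q v) L ≡ allB p L ∧ allB q L
allB-∧ p q []      = refl
allB-∧ p q (x ∷ L) rewrite allB-∧ p q L = shuffle (p x) (q x) (allB p L) (allB q L)
  where
  shuffle : ∀ a b c d → (a ∧ b) ∧ (c ∧ d) ≡ (a ∧ c) ∧ (b ∧ d)
  shuffle true  true  c d = refl
  shuffle true  false c d = sym (∧-zeroʳ c)
  shuffle false b     c d = refl

allB-elim : ∀ {n} (p : Word n → Bool) L v {k} → allB p L ≡ true → count (λ u → eqW u v) L ≡ suc k → p v ≡ true
allB-elim p (x ∷ L) v h c with eqW x v in e
... | true rewrite eqW-sound x v e = ∧-true₁ h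
... | false = allB-elim p L v (∧-true₂ {p x} h) c

allB-allWords : ∀ {n} (p : Word n → Bool) → allB p (allWords n) ≡ true → ∀ v → p v ≡ true
allB-allWords {n} p h v = allB-elim p (allWords n) v h (allWords-unique n v)

bool-ext : ∀ {b c : Bool} → (b ≡ true → c ≡ true) → (c ≡ true → b ≡ true) → b ≡ c
bool-ext {true}  {true}  f g = refl
bool-ext {true}  {false} f g = sym (f refl)
bool-ext {false} {true}  f g = g refl
bool-ext {false} {false} f g = refl

allB-∷ʳ : ∀ {n} (p : Word (suc n) → Bool) →
  allB p (allWords (suc n)) ≡ allB (λ v → p (v ∷ʳ l0) ∧ (p (v ∷ʳ l1) ∧ p (v ∷ʳ l2))) (allWords n)
allB-∷ʳ {n} p = bool-ext to from
  where
  Q : Word n → Bool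
  Q v = p (v ∷ʳ l0) ∧ (p (v ∷ʳ l1) ∧ p (v ∷ʳ l2))
  to : allB p (allWords (suc n)) ≡ true → allB Q (allWords n) ≡ true
  to h = allB-intro Q (allWords n) λ v →
    cong₂ _∧_ (allB-allWords p h (v ∷ʳ l0)) (cong₂ _∧_ (allB-allWords p h (v ∷ʳ l1)) (allB-allWords p h (v ∷ʳ l2)))
  pick : ∀ x u → Q u ≡ true → p (u ∷ʳ x) ≡ true
  pick l0 u e = ∧-true₁ e
  pick l1 u e = ∧-true₁ (∧-true₂ {p (u ∷ʳ l0)} e)
  pick l2 u e = ∧-true₂ {p (u ∷ʳ l1)} (∧-true₂ {p (u ∷ʳ l0)} e)
  from : allB Q (allWords n) ≡ true → allB p (allWords (suc n)) ≡ true
  from h = allB-intro p (allWords (suc n)) λ v → at v (initLast v)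
    where
    at : ∀ v → ∃₂ (λ u x → v ≡ u ∷ʳ x) → p v ≡ true
    at .(u ∷ʳ x) (u , x , refl) = pick x u (allB-allWords Q h u)

-- the corner of the generator s: the unique word fixed by s
fixL : Gen → Letter
fixL ga = l2
fixL gb = l1
fixL gc = l0

cor : Gen → ∀ n → Word n
cor s n = replicate n (fixL s)

-- the action of s on the last letter of a word whose other letters are all fixL s
actL : Gen → Letter → Letter
actL ga l0 = l1
actL ga l1 = l0
actL ga l2 = l2
actL gb l0 = l2
actL gb l1 = l1
actL gb l2 = l0
actL gc l0 = l0
actL gc l1 = l2
actL gc l2 = l1

act-cor : ∀ s n → act s (cor s n) ≡ cor s n
act-cor s  zero    = refl
act-cor ga (suc n) = cong (l2 ∷_) (act-cor ga n)
act-cor gb (suc n) = cong (l1 ∷_) (act-cor gb n)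
act-cor gc (suc n) = cong (l0 ∷_) (act-cor gc n)

∷-injʳ : ∀ {n} {x y : Letter} {u v : Word n} → x ∷ u ≡ y ∷ v → u ≡ v
∷-injʳ refl = refl

act-fixed : ∀ s {n} (u : Word n) → act s u ≡ u → u ≡ cor s n
act-fixed s  []       e = refl
act-fixed ga (l2 ∷ u) e = cong (l2 ∷_) (act-fixed ga u (∷-injʳ e))
act-fixed gb (l1 ∷ u) e = cong (l1 ∷_) (act-fixed gb u (∷-injʳ e))
act-fixed gc (l0 ∷ u) e = cong (l0 ∷_) (act-fixed gc u (∷-injʳ e))
act-fixed ga (l0 ∷ u) ()
act-fixed ga (l1 ∷ u) ()
act-fixed gb (l0 ∷ u) ()
act-fixed gb (l2 ∷ u) ()
act-fixed gc (l1 ∷ u) ()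
act-fixed gc (l2 ∷ u) ()

act-∷ʳ : ∀ s {n} x (u : Word n) → u ≢ cor s n → act s (u ∷ʳ x) ≡ act s u ∷ʳ x
act-∷ʳ s  x []       u≢ = ⊥-elim (u≢ refl)
act-∷ʳ ga x (l0 ∷ u) u≢ = refl
act-∷ʳ ga x (l1 ∷ u) u≢ = refl
act-∷ʳ ga x (l2 ∷ u) u≢ = cong (l2 ∷_) (act-∷ʳ ga x u (λ e → u≢ (cong (l2 ∷_) e)))
act-∷ʳ gb x (l0 ∷ u) u≢ = refl
act-∷ʳ gb x (l2 ∷ u) u≢ = refl
act-∷ʳ gb x (l1 ∷ u) u≢ = cong (l1 ∷_) (act-∷ʳ gb x u (λ e → u≢ (cong (l1 ∷_) e)))
act-∷ʳ gc x (l1 ∷ u) u≢ = refl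
act-∷ʳ gc x (l2 ∷ u) u≢ = refl
act-∷ʳ gc x (l0 ∷ u) u≢ = cong (l0 ∷_) (act-∷ʳ gc x u (λ e → u≢ (cong (l0 ∷_) e)))

act-cor-∷ʳ : ∀ s n x → act s (cor s n ∷ʳ x) ≡ cor s n ∷ʳ actL s x
act-cor-∷ʳ ga zero    l0 = refl
act-cor-∷ʳ ga zero    l1 = refl
act-cor-∷ʳ ga zero    l2 = refl
act-cor-∷ʳ gb zero    l0 = refl
act-cor-∷ʳ gb zero    l1 = refl
act-cor-∷ʳ gb zero    l2 = refl
act-cor-∷ʳ gc zero    l0 = refl
act-cor-∷ʳ gc zero    l1 = refl
act-cor-∷ʳ gc zero    l2 = refl
act-cor-∷ʳ ga (suc n) x  = cong (l2 ∷_) (act-cor-∷ʳ ga n x)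
act-cor-∷ʳ gb (suc n) x  = cong (l1 ∷_) (act-cor-∷ʳ gb n x)
act-cor-∷ʳ gc (suc n) x  = cong (l0 ∷_) (act-cor-∷ʳ gc n x)

≟-refl : ∀ (p : Letter) → ⌊ p Fin.≟ p ⌋ ≡ true
≟-refl l0 = refl
≟-refl l1 = refl
≟-refl l2 = refl

lex-irrefl : ∀ {n} (u : Word n) → (u <lex u) ≡ false
lex-irrefl []      = refl
lex-irrefl (p ∷ u) rewrite ≟-refl p = lex-irrefl u

lex-∷ʳ-same : ∀ {n} x (u v : Word n) → ((u ∷ʳ x) <lex (v ∷ʳ x)) ≡ (u <lex v)
lex-∷ʳ-same x []      []      rewrite ≟-refl x = refl
lex-∷ʳ-same x (p ∷ u) (q ∷ v) = cong (λ t → if ⌊ p Fin.≟ q ⌋ then t else (toℕ p <ᵇ toℕ q)) (lex-∷ʳ-same x u v)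

lex-∷ʳ-last : ∀ {n} x y (u : Word n) → ((u ∷ʳ x) <lex (u ∷ʳ y)) ≡ (toℕ x <ᵇ toℕ y)
lex-∷ʳ-last l0 l0 [] = refl
lex-∷ʳ-last l0 l1 [] = refl
lex-∷ʳ-last l0 l2 [] = refl
lex-∷ʳ-last l1 l0 [] = refl
lex-∷ʳ-last l1 l1 [] = refl
lex-∷ʳ-last l1 l2 [] = refl
lex-∷ʳ-last l2 l0 [] = refl
lex-∷ʳ-last l2 l1 [] = refl
lex-∷ʳ-last l2 l2 [] = refl
lex-∷ʳ-last x y (p ∷ u) rewrite ≟-refl p = lex-∷ʳ-last x y u

pos : ℕ → Bool
pos zero    = false
pos (suc _) = true

ind : Bool → ℕ
ind b = if b then 1 else 0

-- A requirement r prescribes how many times each vertex must be covered.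
-- covers C r: the edges of C cover each vertex v exactly r v times.  Dimer coverings are the case r = 1.
covers : ∀ {n} → List (Edge n) → (Word n → ℕ) → Bool
covers {n} C r = allB (λ v → count (λ e → incident e v) C ≡ᵇ r v) (allWords n)

_⊝_ : ∀ {n} → (Word n → ℕ) → Edge n → Word n → ℕ
(r ⊝ e) v = r v ∸ ind (incident e v)

fits : ∀ {n} → Edge n → (Word n → ℕ) → Bool
fits {n} e r = allB (λ v → not (incident e v) ∨ pos (r v)) (allWords n)

covers-cons : ∀ {n} (e : Edge n) C r → covers (e ∷ C) r ≡ fits e r ∧ covers C (r ⊝ e)
covers-cons {n} e C r =
  ≡-trans (allB-ext (λ v → step (incident e v) (count (λ e' → incident e' v) C) (r v)) (allWords n))
          (allB-∧ _ _ (allWords n))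
  where
  step : ∀ i k m → ((if i then suc k else k) ≡ᵇ m) ≡ ((not i ∨ pos m) ∧ (k ≡ᵇ m ∸ ind i))
  step false k m       = refl
  step true  k zero    = refl
  step true  k (suc m) = refl

covers-cong : ∀ {n} (C : List (Edge n)) {r r'} → (∀ v → r v ≡ r' v) → covers C r ≡ covers C r'
covers-cong {n} C h = allB-ext (λ v → cong (count (λ e → incident e v) C ≡ᵇ_) (h v)) (allWords n)

count-perm : ∀ {A : Set} (p : A → Bool) {C C' : List A} → C ↭ C' → count p C ≡ count p C'
count-perm p refl = refl
count-perm p (prep x q) with p x
... | true  = cong suc (count-perm p q)
... | false = count-perm p q
count-perm p (swap x y q) with p x | p y
... | true  | true  = cong (λ t → suc (suc t)) (count-perm p q)
... | true  | false = cong suc (count-perm p q)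
... | false | true  = cong suc (count-perm p q)
... | false | false = count-perm p q
count-perm p (trans q q') = ≡-trans (count-perm p q) (count-perm p q')

covers-perm : ∀ {n} {C C' : List (Edge n)} r → C ↭ C' → covers C r ≡ covers C' r
covers-perm {n} r q = allB-ext (λ v → cong (_≡ᵇ r v) (count-perm _ q)) (allWords n)

if-scale : ∀ (d : Bool) k x → (if d then k * x else 0ℚ) ≡ k * (if d then x else 0ℚ)
if-scale true  k x = refl
if-scale false k x = sym (*-zeroʳ k)

module PartitionFunction (a b c : ℚ) where

  W : ∀ {n} → List (Edge n) → ℚ
  W = weight a b c

  w : ∀ {n} → Edge n → ℚ
  w e = wt a b c (label e)

  W-perm : ∀ {n} → PermInvariant (W {n})
  W-perm refl       = refl
  W-perm (prep x q) = cong (w x *_) (W-perm q)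
  W-perm {C = x ∷ y ∷ C} {.y ∷ .x ∷ C'} (swap x y q) = begin
    w x * (w y * W C)    ≡⟨ cong (λ t → w x * (w y * t)) (W-perm q) ⟩
    w x * (w y * W C')   ≡⟨ sym (*-assoc (w x) (w y) _) ⟩
    (w x * w y) * W C'   ≡⟨ cong (_* W C') (*-comm (w x) (w y)) ⟩
    (w y * w x) * W C'   ≡⟨ *-assoc (w y) (w x) _ ⟩
    w y * (w x * W C')   ∎
    where open ≡-Reasoning
  W-perm (trans q q') = ≡-trans (W-perm q) (W-perm q')

  Zterm : ∀ {n} → (Word n → ℕ) → List (Edge n) → ℚ
  Zterm r C = if covers C r then W C else 0ℚ

  Z : ∀ {n} → List (Edge n) → (Word n → ℕ) → ℚ
  Z E r = Σsub (Zterm r) E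

  Z-perm : ∀ {n} {E E' : List (Edge n)} r → E ↭ E' → Z E r ≡ Z E' r
  Z-perm r = Σsub-perm (Zterm r) λ q → cong₂ (λ d x → if d then x else 0ℚ) (covers-perm r q) (W-perm q)

  Z-cong : ∀ {n} (E : List (Edge n)) {r r'} → (∀ v → r v ≡ r' v) → Z E r ≡ Z E r'
  Z-cong E h = Σsub-cong (λ C → cong (λ d → if d then W C else 0ℚ) (covers-cong C h)) E

  Z-nil : ∀ {n} (r : Word n → ℕ) → Z [] r ≡ (if covers [] r then 1ℚ else 0ℚ)
  Z-nil r with covers [] r
  ... | true  = +-identityʳ 1ℚ
  ... | false = +-identityʳ 0ℚ

  Z-cons : ∀ {n} (e : Edge n) E r → Z (e ∷ E) r ≡ (if fits e r then w e * Z E (r ⊝ e) else 0ℚ) + Z E r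
  Z-cons e E r = ≡-trans (Σsub-cons (Zterm r) e E) (cong (_+ Z E r) used)
    where
    covers-e : ∀ C → covers (e ∷ C) r ≡ fits e r ∧ covers C (r ⊝ e)
    covers-e C = covers-cons e C r
    used : Σsub (λ C → Zterm r (e ∷ C)) E ≡ (if fits e r then w e * Z E (r ⊝ e) else 0ℚ)
    used with fits e r in h
    ... | true  = ≡-trans (Σsub-cong (λ C → ≡-trans
                            (cong (λ d → if d then W (e ∷ C) else 0ℚ) (≡-trans (covers-e C) (cong (_∧ covers C (r ⊝ e)) h)))
                            (if-scale (covers C (r ⊝ e)) (w e) (W C))) E)
                          (Σsub-scale (w e) (Zterm (r ⊝ e)) E)
    ... | false = ≡-trans (Σsub-cong (λ C →
                            cong (λ d → if d then W (e ∷ C) else 0ℚ) (≡-trans (covers-e C) (cong (_∧ covers C (r ⊝ e)) h))) E)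
                          (Σsub-zero E)

-- an edge of Σ_n away from the corner of its label; its copies in Σ_(n+1) are again edges
AwayFromCorner : ∀ {n} → Edge n → Set
AwayFromCorner {n} (s , u) = u ≢ cor s n

_∷ʳᵉ_ : ∀ {n} → Edge n → Letter → Edge (suc n)
(s , u) ∷ʳᵉ x = (s , u ∷ʳ x)

_↾_ : ∀ {n} → (Word (suc n) → ℕ) → Letter → Word n → ℕ
(r ↾ x) u = r (u ∷ʳ x)

incident-eqW : ∀ {n} s (u v : Word n) → incident (s , u) v ≡ (eqW u v ∨ eqW (act s u) v)
incident-eqW s u v = cong₂ _∨_ (==w-eqW u v) (==w-eqW (act s u) v)

incident-∷ʳ : ∀ {n} (e : Edge n) → AwayFromCorner e → ∀ x y v →
  incident (e ∷ʳᵉ x) (v ∷ʳ y) ≡ incident e v ∧ eqL x y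
incident-∷ʳ (s , u) away x y v rewrite incident-eqW s (u ∷ʳ x) (v ∷ʳ y) | act-∷ʳ s x u away
  | eqW-∷ʳ x y u v | eqW-∷ʳ x y (act s u) v | incident-eqW s u v =
  sym (∧-distribʳ-∨ (eqL x y) (eqW u v) (eqW (act s u) v))

⊝-∷ʳ-same : ∀ {n} (e : Edge n) → AwayFromCorner e → ∀ x r v → ((r ⊝ (e ∷ʳᵉ x)) ↾ x) v ≡ ((r ↾ x) ⊝ e) v
⊝-∷ʳ-same e away x r v rewrite incident-∷ʳ e away x x v | eqL-refl x | ∧-identityʳ (incident e v) = refl

⊝-∷ʳ-other : ∀ {n} (e : Edge n) → AwayFromCorner e → ∀ x y r → y ≢ x → ∀ v → ((r ⊝ (e ∷ʳᵉ x)) ↾ y) v ≡ (r ↾ y) v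
⊝-∷ʳ-other e away x y r y≢x v rewrite incident-∷ʳ e away x y v | eqL-≢ x y y≢x | ∧-zeroʳ (incident e v) = refl

fits-∷ʳ : ∀ {n} (e : Edge n) → AwayFromCorner e → ∀ x (r : Word (suc n) → ℕ) → fits (e ∷ʳᵉ x) r ≡ fits e (r ↾ x)
fits-∷ʳ {n} e away x r = ≡-trans (allB-∷ʳ P) (allB-ext pointwise (allWords n))
  where
  P : Word (suc n) → Bool
  P v = not (incident (e ∷ʳᵉ x) v) ∨ pos (r v)
  select : ∀ (i : Bool) (x : Letter) (p0 p1 p2 : Bool) →
    ((not (i ∧ eqL x l0) ∨ p0) ∧ ((not (i ∧ eqL x l1) ∨ p1) ∧ (not (i ∧ eqL x l2) ∨ p2)))
    ≡ (not i ∨ (if eqL x l0 then p0 else if eqL x l1 then p1 else p2))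
  select true  l0 p0 p1 p2 = ∧-identityʳ _
  select true  l1 p0 p1 p2 = ∧-identityʳ _
  select true  l2 p0 p1 p2 = refl
  select false l0 p0 p1 p2 = refl
  select false l1 p0 p1 p2 = refl
  select false l2 p0 p1 p2 = refl
  selected : ∀ (f : Letter → Bool) x → (if eqL x l0 then f l0 else if eqL x l1 then f l1 else f l2) ≡ f x
  selected f l0 = refl
  selected f l1 = refl
  selected f l2 = refl
  pointwise : ∀ v → (P (v ∷ʳ l0) ∧ (P (v ∷ʳ l1) ∧ P (v ∷ʳ l2))) ≡ (not (incident e v) ∨ pos (r (v ∷ʳ x)))
  pointwise v = ≡-trans (cong₂ _∧_ (at l0) (cong₂ _∧_ (at l1) (at l2)))
    (≡-trans (select (incident e v) x _ _ _) (cong (not (incident e v) ∨_) (selected (λ y → pos (r (v ∷ʳ y))) x)))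
    where
    at : ∀ y → P (v ∷ʳ y) ≡ (not (incident e v ∧ eqL x y) ∨ pos (r (v ∷ʳ y)))
    at y = cong (λ t → not t ∨ pos (r (v ∷ʳ y))) (incident-∷ʳ e away x y v)

indℚ : Bool → ℚ
indℚ d = if d then 1ℚ else 0ℚ

indicator-∧ : ∀ p q r → indℚ (p ∧ (q ∧ r)) ≡ indℚ p * indℚ q * indℚ r
indicator-∧ true  true  true  = refl
indicator-∧ true  true  false = refl
indicator-∧ true  false r     = sym (≡-trans (cong (_* indℚ r) (*-zeroʳ 1ℚ)) (*-zeroˡ (indℚ r)))
indicator-∧ false q     r     = sym (≡-trans (cong (_* indℚ r) (*-zeroˡ (indℚ q))) (*-zeroˡ (indℚ r)))

ℚ-ring : AlmostCommutativeRing 0ℓ 0ℓ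
ℚ-ring = fromCommutativeRing +-*-commutativeRing (λ _ → nothing)

pull₀ : ∀ d k x' x y z → (if d then k * (x' * y * z) else 0ℚ) + x * y * z ≡ ((if d then k * x' else 0ℚ) + x) * y * z
pull₀ true  = ring
  where
  ring : ∀ k x' x y z → k * (x' * y * z) + x * y * z ≡ (k * x' + x) * y * z
  ring = solve-∀ ℚ-ring
pull₀ false k x' x y z = ≡-trans (+-identityˡ _) (cong (λ t → t * y * z) (sym (+-identityˡ x)))

pull₁ : ∀ d k y' x y z → (if d then k * (x * y' * z) else 0ℚ) + x * y * z ≡ x * ((if d then k * y' else 0ℚ) + y) * z
pull₁ true  = ring
  where
  ring : ∀ k y' x y z → k * (x * y' * z) + x * y * z ≡ x * (k * y' + y) * z
  ring = solve-∀ ℚ-ring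
pull₁ false k y' x y z = ≡-trans (+-identityˡ _) (cong (λ t → x * t * z) (sym (+-identityˡ y)))

pull₂ : ∀ d k z' x y z → (if d then k * (x * y * z') else 0ℚ) + x * y * z ≡ x * y * ((if d then k * z' else 0ℚ) + z)
pull₂ true  = ring
  where
  ring : ∀ k z' x y z → k * (x * y * z') + x * y * z ≡ x * y * (k * z' + z)
  ring = solve-∀ ℚ-ring
pull₂ false k z' x y z = ≡-trans (+-identityˡ _) (cong (λ t → x * y * t) (sym (+-identityˡ z)))

module Copies (a b c : ℚ) where
  open PartitionFunction a b c

  Z-nil-copies : ∀ {n} (r : Word (suc n) → ℕ) → Z [] r ≡ Z [] (r ↾ l0) * Z [] (r ↾ l1) * Z [] (r ↾ l2)
  Z-nil-copies {n} r rewrite Z-nil r | Z-nil (r ↾ l0) | Z-nil (r ↾ l1) | Z-nil (r ↾ l2) =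
    ≡-trans (cong indℚ split) (indicator-∧ (covers [] (r ↾ l0)) _ _)
    where
    p : Letter → Word n → Bool
    p x v = 0 ≡ᵇ (r ↾ x) v
    split : covers [] r ≡ covers [] (r ↾ l0) ∧ (covers [] (r ↾ l1) ∧ covers [] (r ↾ l2))
    split = ≡-trans (allB-∷ʳ (λ v → 0 ≡ᵇ r v)) (≡-trans (allB-∧ (p l0) (λ v → p l1 v ∧ p l2 v) (allWords n))
              (cong (covers [] (r ↾ l0) ∧_) (allB-∧ (p l1) (p l2) (allWords n))))

  Z-peel : ∀ {n} x (e : Edge n) R r → AwayFromCorner e →
    Z ((e ∷ʳᵉ x) ∷ R) r ≡ (if fits e (r ↾ x) then w e * Z R (r ⊝ (e ∷ʳᵉ x)) else 0ℚ) + Z R r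
  Z-peel x e R r away = ≡-trans (Z-cons (e ∷ʳᵉ x) R r)
    (cong (λ d → (if d then w e * Z R (r ⊝ (e ∷ʳᵉ x)) else 0ℚ) + Z R r) (fits-∷ʳ e away x r))

  Z-copy₂ : ∀ {n} (E₂ : List (Edge n)) → All AwayFromCorner E₂ → (r : Word (suc n) → ℕ) →
    Z (map (_∷ʳᵉ l2) E₂) r ≡ Z [] (r ↾ l0) * Z [] (r ↾ l1) * Z E₂ (r ↾ l2)
  Z-copy₂ [] [] r = Z-nil-copies r
  Z-copy₂ (e ∷ E₂) (away ∷ aways) r rewrite Z-peel l2 e (map (_∷ʳᵉ l2) E₂) r away
    | Z-copy₂ E₂ aways (r ⊝ (e ∷ʳᵉ l2)) | Z-copy₂ E₂ aways r | Z-cons e E₂ (r ↾ l2)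
    | Z-cong [] (⊝-∷ʳ-other e away l2 l0 r (λ ()))
    | Z-cong [] (⊝-∷ʳ-other e away l2 l1 r (λ ()))
    | Z-cong E₂ (⊝-∷ʳ-same e away l2 r) =
    pull₂ (fits e (r ↾ l2)) (w e) (Z E₂ ((r ↾ l2) ⊝ e)) (Z [] (r ↾ l0)) (Z [] (r ↾ l1)) (Z E₂ (r ↾ l2))

  Z-copy₁₂ : ∀ {n} (E₁ E₂ : List (Edge n)) → All AwayFromCorner E₁ → All AwayFromCorner E₂ → (r : Word (suc n) → ℕ) →
    Z (map (_∷ʳᵉ l1) E₁ ++ map (_∷ʳᵉ l2) E₂) r ≡ Z [] (r ↾ l0) * Z E₁ (r ↾ l1) * Z E₂ (r ↾ l2)
  Z-copy₁₂ [] E₂ [] aways₂ r = Z-copy₂ E₂ aways₂ r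
  Z-copy₁₂ (e ∷ E₁) E₂ (away ∷ aways) aways₂ r rewrite Z-peel l1 e (map (_∷ʳᵉ l1) E₁ ++ map (_∷ʳᵉ l2) E₂) r away
    | Z-copy₁₂ E₁ E₂ aways aways₂ (r ⊝ (e ∷ʳᵉ l1)) | Z-copy₁₂ E₁ E₂ aways aways₂ r | Z-cons e E₁ (r ↾ l1)
    | Z-cong [] (⊝-∷ʳ-other e away l1 l0 r (λ ()))
    | Z-cong E₂ (⊝-∷ʳ-other e away l1 l2 r (λ ()))
    | Z-cong E₁ (⊝-∷ʳ-same e away l1 r) =
    pull₁ (fits e (r ↾ l1)) (w e) (Z E₁ ((r ↾ l1) ⊝ e)) (Z [] (r ↾ l0)) (Z E₁ (r ↾ l1)) (Z E₂ (r ↾ l2))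

  Z-copies : ∀ {n} (E₀ E₁ E₂ : List (Edge n)) →
    All AwayFromCorner E₀ → All AwayFromCorner E₁ → All AwayFromCorner E₂ → (r : Word (suc n) → ℕ) →
    Z (map (_∷ʳᵉ l0) E₀ ++ map (_∷ʳᵉ l1) E₁ ++ map (_∷ʳᵉ l2) E₂) r ≡ Z E₀ (r ↾ l0) * Z E₁ (r ↾ l1) * Z E₂ (r ↾ l2)
  Z-copies [] E₁ E₂ [] aways₁ aways₂ r = Z-copy₁₂ E₁ E₂ aways₁ aways₂ r
  Z-copies (e ∷ E₀) E₁ E₂ (away ∷ aways) aways₁ aways₂ r
    rewrite Z-peel l0 e (map (_∷ʳᵉ l0) E₀ ++ map (_∷ʳᵉ l1) E₁ ++ map (_∷ʳᵉ l2) E₂) r away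
    | Z-copies E₀ E₁ E₂ aways aways₁ aways₂ (r ⊝ (e ∷ʳᵉ l0)) | Z-copies E₀ E₁ E₂ aways aways₁ aways₂ r
    | Z-cons e E₀ (r ↾ l0)
    | Z-cong E₁ (⊝-∷ʳ-other e away l0 l1 r (λ ()))
    | Z-cong E₂ (⊝-∷ʳ-other e away l0 l2 r (λ ()))
    | Z-cong E₀ (⊝-∷ʳ-same e away l0 r) =
    pull₀ (fits e (r ↾ l0)) (w e) (Z E₀ ((r ↾ l0) ⊝ e)) (Z E₀ (r ↾ l0)) (Z E₁ (r ↾ l1)) (Z E₂ (r ↾ l2))

odd : ℕ → Bool
odd zero    = false
odd (suc n) = not (odd n)

odd-+ : ∀ m k → odd (m ℕ.+ k) ≡ odd m xor odd k
odd-+ zero    k = refl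
odd-+ (suc m) k rewrite odd-+ m k with odd m | odd k
... | true  | true  = refl
... | true  | false = refl
... | false | true  = refl
... | false | false = refl

odd-+2 : ∀ m → odd (m ℕ.+ 2) ≡ odd m
odd-+2 zero    = refl
odd-+2 (suc m) = cong not (odd-+2 m)

sumℕ : ∀ {A : Set} → (A → ℕ) → List A → ℕ
sumℕ r = foldr (λ v acc → r v ℕ.+ acc) 0

total : ∀ {n} → (Word n → ℕ) → ℕ
total {n} r = sumℕ r (allWords n)

sumℕ-⊝ : ∀ {n} (e : Edge n) r L → allB (λ v → not (incident e v) ∨ pos (r v)) L ≡ true →
  sumℕ r L ≡ sumℕ (r ⊝ e) L ℕ.+ count (λ v → incident e v) L
sumℕ-⊝ e r []      h = refl
sumℕ-⊝ e r (v ∷ L) h = step (incident e v) (r v) (∧-true₁ h)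
  (sumℕ-⊝ e r L (∧-true₂ {not (incident e v) ∨ pos (r v)} h))
  where
  step : ∀ i m {S S' C} → (not i ∨ pos m) ≡ true → S ≡ S' ℕ.+ C →
    m ℕ.+ S ≡ (m ∸ ind i ℕ.+ S') ℕ.+ (if i then suc C else C)
  step false m       {S' = S'} {C} _ refl = sym (ℕₚ.+-assoc m S' C)
  step true  (suc m) {S' = S'} {C} _ refl =
    ≡-trans (cong suc (sym (ℕₚ.+-assoc m S' C))) (sym (ℕₚ.+-suc (m ℕ.+ S') C))

count-∨ : ∀ {A : Set} (p q : A → Bool) → (∀ v → p v ∧ q v ≡ false) → ∀ L →
  count (λ v → p v ∨ q v) L ≡ count p L ℕ.+ count q L
count-∨ p q disjoint [] = refl
count-∨ p q disjoint (x ∷ L) with p x in e₁ | q x in e₂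
... | true  | true  = ⊥-elim (false≢true (≡-trans (sym (disjoint x)) (cong₂ _∧_ e₁ e₂)))
... | true  | false = cong suc (count-∨ p q disjoint L)
... | false | true  = ≡-trans (cong suc (count-∨ p q disjoint L)) (sym (ℕₚ.+-suc _ _))
... | false | false = count-∨ p q disjoint L

NonLoop : ∀ {n} → Edge n → Set
NonLoop (s , u) = act s u ≢ u

endpoints : ∀ {n} (e : Edge n) → NonLoop e → count (λ v → incident e v) (allWords n) ≡ 2
endpoints {n} (s , u) nonloop =
  ≡-trans (count-cong (incident-eqW s u) (allWords n))
  (≡-trans (count-∨ _ _ disjoint (allWords n)) (cong₂ ℕ._+_ (allWords-unique′ u) (allWords-unique′ (act s u))))
  where
  disjoint : ∀ v → eqW u v ∧ eqW (act s u) v ≡ false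
  disjoint v with eqW u v in e₁ | eqW (act s u) v in e₂
  ... | true  | true  = ⊥-elim (nonloop (≡-trans (eqW-sound _ _ e₂) (sym (eqW-sound _ _ e₁))))
  ... | true  | false = refl
  ... | false | _     = refl

total-covered : ∀ {n} (r : Word n → ℕ) L → allB (λ v → 0 ≡ᵇ r v) L ≡ true → sumℕ r L ≡ 0
total-covered r []      h = refl
total-covered r (v ∷ L) h with r v
... | zero  = total-covered r L h
... | suc k = ⊥-elim (false≢true h)

odd-total-⊝ : ∀ {n} (e : Edge n) r → NonLoop e → fits e r ≡ true → odd (total (r ⊝ e)) ≡ odd (total r)
odd-total-⊝ {n} e r nonloop fit = begin
  odd (total (r ⊝ e))                                                ≡⟨ sym (odd-+2 (total (r ⊝ e))) ⟩
  odd (total (r ⊝ e) ℕ.+ 2)                                          ≡⟨ cong (λ k → odd (total (r ⊝ e) ℕ.+ k)) (sym (endpoints e nonloop)) ⟩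
  odd (total (r ⊝ e) ℕ.+ count (λ v → incident e v) (allWords n))    ≡⟨ cong odd (sym (sumℕ-⊝ e r (allWords n) fit)) ⟩
  odd (total r)                                                      ∎
  where open ≡-Reasoning

module Parity (a b c : ℚ) where
  open PartitionFunction a b c

  Z-odd : ∀ {n} (E : List (Edge n)) → All NonLoop E → ∀ r → odd (total r) ≡ true → Z E r ≡ 0ℚ
  Z-odd {n} [] [] r h rewrite Z-nil r with covers [] r in e
  ... | true  = ⊥-elim (false≢true (≡-trans (sym (cong odd (total-covered r (allWords n) e))) h))
  ... | false = refl
  Z-odd {n} (e ∷ E) (nonloop ∷ nonloops) r h rewrite Z-cons e E r | Z-odd E nonloops r h with fits e r in fit
  ... | true rewrite Z-odd E nonloops (r ⊝ e) (≡-trans (odd-total-⊝ e r nonloop fit) h) | *-zeroʳ (w e) =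
    +-identityʳ 0ℚ
  ... | false = +-identityʳ 0ℚ

module _ {A : Set} where
  open import Algebra.Solver.CommutativeMonoid (++-commutativeMonoid {A = A})

  transpose₃ : ∀ (a0 a1 a2 b0 b1 b2 c0 c1 c2 : List A) →
    (a0 ++ (a1 ++ a2)) ++ ((b0 ++ (b1 ++ b2)) ++ ((c0 ++ (c1 ++ c2)) ++ [])) ↭
    (a0 ++ (b0 ++ (c0 ++ []))) ++ ((a1 ++ (b1 ++ (c1 ++ []))) ++ (a2 ++ (b2 ++ (c2 ++ []))))
  transpose₃ a0 a1 a2 b0 b1 b2 c0 c1 c2 = prove 9
    ((var (# 0) ⊕ (var (# 1) ⊕ var (# 2))) ⊕ ((var (# 3) ⊕ (var (# 4) ⊕ var (# 5))) ⊕ ((var (# 6) ⊕ (var (# 7) ⊕ var (# 8))) ⊕ id)))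
    ((var (# 0) ⊕ (var (# 3) ⊕ (var (# 6) ⊕ id))) ⊕ ((var (# 1) ⊕ (var (# 4) ⊕ (var (# 7) ⊕ id))) ⊕ (var (# 2) ⊕ (var (# 5) ⊕ (var (# 8) ⊕ id)))))
    (a0 ∷ a1 ∷ a2 ∷ b0 ∷ b1 ∷ b2 ∷ c0 ∷ c1 ∷ c2 ∷ [])

  heads₃ : ∀ (la lb lc X Y Z : List A) →
    (la ++ X) ++ ((lb ++ Y) ++ ((lc ++ Z) ++ [])) ↭ la ++ (lb ++ (lc ++ (X ++ (Y ++ (Z ++ [])))))
  heads₃ la lb lc X Y Z = prove 6 ((var (# 0) ⊕ var (# 3)) ⊕ ((var (# 1) ⊕ var (# 4)) ⊕ ((var (# 2) ⊕ var (# 5)) ⊕ id)))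
    (var (# 0) ⊕ (var (# 1) ⊕ (var (# 2) ⊕ (var (# 3) ⊕ (var (# 4) ⊕ (var (# 5) ⊕ id)))))) (la ∷ lb ∷ lc ∷ X ∷ Y ∷ Z ∷ [])

  -- moving the bridges (one per label, the third one inside its second block) to the front and
  -- regrouping the remaining 3 × 3 blocks from labels to copies
  bridges-first : ∀ (ba bb bc a0 a1 a2 b0 b1 b2 c0 c1 c2 : List A) →
    (ba ++ (a0 ++ (a1 ++ a2))) ++ ((bb ++ (b0 ++ (b1 ++ b2))) ++ ((c0 ++ (bc ++ (c1 ++ c2))) ++ [])) ↭
    ba ++ (bb ++ (bc ++ ((a0 ++ (b0 ++ (c0 ++ []))) ++ ((a1 ++ (b1 ++ (c1 ++ []))) ++ (a2 ++ (b2 ++ (c2 ++ [])))))))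
  bridges-first ba bb bc a0 a1 a2 b0 b1 b2 c0 c1 c2 = prove 12
    ((var (# 0) ⊕ (var (# 3) ⊕ (var (# 4) ⊕ var (# 5)))) ⊕ ((var (# 1) ⊕ (var (# 6) ⊕ (var (# 7) ⊕ var (# 8))))
      ⊕ ((var (# 9) ⊕ (var (# 2) ⊕ (var (# 10) ⊕ var (# 11)))) ⊕ id)))
    (var (# 0) ⊕ (var (# 1) ⊕ (var (# 2) ⊕ ((var (# 3) ⊕ (var (# 6) ⊕ (var (# 9) ⊕ id)))
      ⊕ ((var (# 4) ⊕ (var (# 7) ⊕ (var (# 10) ⊕ id))) ⊕ (var (# 5) ⊕ (var (# 8) ⊕ (var (# 11) ⊕ id))))))))
    (ba ∷ bb ∷ bc ∷ a0 ∷ a1 ∷ a2 ∷ b0 ∷ b1 ∷ b2 ∷ c0 ∷ c1 ∷ c2 ∷ [])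

  bfilter-++ : ∀ (p : A → Bool) xs ys → bfilter p (xs ++ ys) ≡ bfilter p xs ++ bfilter p ys
  bfilter-++ p []       ys = refl
  bfilter-++ p (x ∷ xs) ys with p x
  ... | true  = cong (x ∷_) (bfilter-++ p xs ys)
  ... | false = bfilter-++ p xs ys

  bfilter-↭ : ∀ (p : A → Bool) {xs ys} → xs ↭ ys → bfilter p xs ↭ bfilter p ys
  bfilter-↭ p refl = refl
  bfilter-↭ p (prep x q) with p x
  ... | true  = prep x (bfilter-↭ p q)
  ... | false = bfilter-↭ p q
  bfilter-↭ p (swap x y q) with p x | p y
  ... | true  | true  = swap x y (bfilter-↭ p q)
  ... | true  | false = prep x (bfilter-↭ p q)
  ... | false | true  = prep y (bfilter-↭ p q)
  ... | false | false = bfilter-↭ p q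
  bfilter-↭ p (trans q q') = trans (bfilter-↭ p q) (bfilter-↭ p q')

  bfilter-All : ∀ (p : A → Bool) L → All (λ x → p x ≡ true) (bfilter p L)
  bfilter-All p []      = []
  bfilter-All p (x ∷ L) with p x in e
  ... | true  = e ∷ bfilter-All p L
  ... | false = bfilter-All p L

bfilter-map : ∀ {A B : Set} (p : A → Bool) (f : B → A) L → bfilter p (map f L) ≡ map f (bfilter (λ x → p (f x)) L)
bfilter-map p f []      = refl
bfilter-map p f (x ∷ L) with p (f x)
... | true  = cong (f x ∷_) (bfilter-map p f L)
... | false = bfilter-map p f L

bfilter-off : ∀ {n} (p q : Word n → Bool) (v : Word n) L → count (λ u → eqW u v) L ≡ 0 →
  (∀ u → u ≢ v → p u ≡ q u) → bfilter p L ≡ bfilter q L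
bfilter-off p q v []      _ _ = refl
bfilter-off p q v (x ∷ L) c h with eqW x v in e
... | true  = ⊥-elim (suc≢0 c) where
  suc≢0 : ∀ {k} → suc k ≢ 0
  suc≢0 ()
... | false rewrite h x (λ x≡v → false≢true (≡-trans (sym e) (≡-trans (cong (λ t → eqW t v) x≡v) (eqW-refl v))))
  with q x
...   | true  = cong (x ∷_) (bfilter-off p q v L c h)
...   | false = bfilter-off p q v L c h

bfilter-once : ∀ {n} (p q : Word n → Bool) (v : Word n) L → count (λ u → eqW u v) L ≡ 1 →
  (∀ u → u ≢ v → p u ≡ q u) → q v ≡ false → bfilter p L ↭ (if p v then [ v ] else []) ++ bfilter q L
bfilter-once p q v (x ∷ L) c h qv with eqW x v in e
... | true rewrite eqW-sound x v e | qv | bfilter-off p q v L (cong ℕ.pred c) h with p v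
...   | true  = refl
...   | false = refl
bfilter-once p q v (x ∷ L) c h qv | false
  rewrite h x (λ x≡v → false≢true (≡-trans (sym e) (≡-trans (cong (λ t → eqW t v) x≡v) (eqW-refl v))))
  with q x | bfilter-once p q v L c h qv
... | false | ih = ih
... | true  | ih with p v
...   | true  = trans (prep x ih) (swap x v refl)
...   | false = prep x ih

allWords-∷ʳ : ∀ n → allWords (suc n) ↭ map (_∷ʳ l0) (allWords n) ++ (map (_∷ʳ l1) (allWords n) ++ map (_∷ʳ l2) (allWords n))
allWords-∷ʳ zero    = refl
allWords-∷ʳ (suc n) =
  trans (++⁺ (map⁺ (l0 ∷_) (allWords-∷ʳ n)) (++⁺ (map⁺ (l1 ∷_) (allWords-∷ʳ n)) (++⁺ (map⁺ (l2 ∷_) (allWords-∷ʳ n)) refl)))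
  (trans (↭-reflexive (cong₂ _++_ (row l0) (cong₂ _++_ (row l1) (cong₂ _++_ (row l2) refl))))
  (trans (transpose₃ (m l0 l0) (m l0 l1) (m l0 l2) (m l1 l0) (m l1 l1) (m l1 l2) (m l2 l0) (m l2 l1) (m l2 l2))
         (↭-reflexive (sym (cong₂ _++_ (column l0) (cong₂ _++_ (column l1) (column l2)))))))
  where
  W : List (Word n)
  W = allWords n
  m : Letter → Letter → List (Word (suc (suc n)))
  m y x = map (_∷ʳ x) (map (y ∷_) W)
  commute : ∀ y x → map (y ∷_) (map (_∷ʳ x) W) ≡ map (_∷ʳ x) (map (y ∷_) W)
  commute y x = ≡-trans (sym (List.map-∘ W)) (List.map-∘ W)
  row : ∀ y → map (y ∷_) (map (_∷ʳ l0) W ++ (map (_∷ʳ l1) W ++ map (_∷ʳ l2) W)) ≡ m y l0 ++ (m y l1 ++ m y l2)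
  row y = ≡-trans (List.map-++ (y ∷_) (map (_∷ʳ l0) W) _) (cong₂ _++_ (commute y l0)
          (≡-trans (List.map-++ (y ∷_) (map (_∷ʳ l1) W) _) (cong₂ _++_ (commute y l1) (commute y l2))))
  column : ∀ x → map (_∷ʳ x) (allWords (suc n)) ≡ m l0 x ++ (m l1 x ++ (m l2 x ++ []))
  column x = ≡-trans (List.map-++ (_∷ʳ x) (map (l0 ∷_) W) _) (cong (m l0 x ++_)
             (≡-trans (List.map-++ (_∷ʳ x) (map (l1 ∷_) W) _) (cong (m l1 x ++_) (List.map-++ (_∷ʳ x) (map (l2 ∷_) W) []))))

-- Defs lists the edge {u, s u} at its lexicographically smaller endpoint u;
-- the inner edges of label s are those other than the loop at the corner of s
keep : ∀ {n} → Gen → Word n → Bool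
keep s u = not (act s u <lex u)

keepInner : ∀ {n} → Gen → Word n → Bool
keepInner {n} s u = keep s u ∧ not (eqW u (cor s n))

innerOf : Gen → ∀ n → List (Word n)
innerOf s n = bfilter (keepInner s) (allWords n)

byLabel : ∀ {n} → (Gen → List (Word n)) → List (Edge n)
byLabel F = map (ga ,_) (F ga) ++ (map (gb ,_) (F gb) ++ (map (gc ,_) (F gc) ++ []))

inner : ∀ n → List (Edge n)
inner n = byLabel (λ s → innerOf s n)

loop : Gen → ∀ n → Edge n
loop s n = (s , cor s n)

keep-cor : ∀ s n → keep s (cor s n) ≡ true
keep-cor s n rewrite act-cor s n | lex-irrefl (cor s n) = refl

keepInner-cor : ∀ s n → keepInner s (cor s n) ≡ false
keepInner-cor s n rewrite eqW-refl (cor s n) = ∧-zeroʳ _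

keep-inner : ∀ {n} s (u : Word n) → u ≢ cor s n → keep s u ≡ keepInner s u
keep-inner s u u≢ rewrite eqW-≢ u _ u≢ = sym (∧-identityʳ _)

edges-loops : ∀ n → edges n ↭ loop ga n ∷ loop gb n ∷ loop gc n ∷ inner n
edges-loops n =
  trans (++⁺ (map⁺ (ga ,_) (split ga)) (++⁺ (map⁺ (gb ,_) (split gb)) (++⁺ (map⁺ (gc ,_) (split gc)) refl)))
        (heads₃ [ loop ga n ] [ loop gb n ] [ loop gc n ] _ _ _)
  where
  split : ∀ s → bfilter (keep s) (allWords n) ↭ cor s n ∷ innerOf s n
  split s = subst (λ t → bfilter (keep s) (allWords n) ↭ (if t then [ cor s n ] else []) ++ innerOf s n) (keep-cor s n)
    (bfilter-once (keep s) (keepInner s) (cor s n) (allWords n) (allWords-unique n _) (keep-inner s) (keepInner-cor s n))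

inner-away : ∀ n → All AwayFromCorner (inner n)
inner-away n = AllP.++⁺ (away ga) (AllP.++⁺ (away gb) (AllP.++⁺ (away gc) []))
  where
  away : ∀ s → All AwayFromCorner (map (s ,_) (innerOf s n))
  away s = AllP.map⁺ (All-map (λ {u} kept u≡ →
    false≢true (≡-trans (sym (≡-trans (cong (keepInner s) u≡) (keepInner-cor s n))) kept))
    (bfilter-All (keepInner s) (allWords n)))

keepInner-cor-∷ʳ : ∀ s n x → keepInner s (cor s n ∷ʳ x) ≡ (not (toℕ (actL s x) <ᵇ toℕ x) ∧ not (eqL x (fixL s)))
keepInner-cor-∷ʳ s n x rewrite act-cor-∷ʳ s n x | lex-∷ʳ-last (actL s x) x (cor s n) | sym (replicate-∷ʳ n (fixL s))
  | eqW-∷ʳ x (fixL s) (cor s n) (cor s n) | eqW-refl (cor s n) = refl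

keepInner-∷ʳ : ∀ s {n} x (u : Word n) → u ≢ cor s n → keepInner s (u ∷ʳ x) ≡ keepInner s u
keepInner-∷ʳ s {n} x u u≢ rewrite act-∷ʳ s x u u≢ | lex-∷ʳ-same x (act s u) u | sym (replicate-∷ʳ n (fixL s))
  | eqW-∷ʳ x (fixL s) u (cor s n) | eqW-≢ u _ u≢ = refl

-- the corner of copy x of Σ_n is the lexicographically smaller endpoint of the bridge of label s
bridgeAt : Gen → Letter → Bool
bridgeAt s x = not (toℕ (actL s x) <ᵇ toℕ x) ∧ not (eqL x (fixL s))

innerOf-copy : ∀ s n x → bfilter (λ u → keepInner s (u ∷ʳ x)) (allWords n) ↭
  (if bridgeAt s x then [ cor s n ] else []) ++ innerOf s n
innerOf-copy s n x = subst (λ t → bfilter (λ u → keepInner s (u ∷ʳ x)) (allWords n) ↭ (if t then [ cor s n ] else []) ++ innerOf s n)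
  (keepInner-cor-∷ʳ s n x)
  (bfilter-once (λ u → keepInner s (u ∷ʳ x)) (keepInner s) (cor s n) (allWords n)
    (allWords-unique n _) (keepInner-∷ʳ s x) (keepInner-cor s n))

innerOf-suc : ∀ s n → innerOf s (suc n) ↭
  map (_∷ʳ l0) ((if bridgeAt s l0 then [ cor s n ] else []) ++ innerOf s n) ++
  (map (_∷ʳ l1) ((if bridgeAt s l1 then [ cor s n ] else []) ++ innerOf s n) ++
   map (_∷ʳ l2) ((if bridgeAt s l2 then [ cor s n ] else []) ++ innerOf s n))
innerOf-suc s n =
  trans (bfilter-↭ (keepInner s) (allWords-∷ʳ n))
  (trans (↭-reflexive (≡-trans (bfilter-++ (keepInner s) (map (_∷ʳ l0) W) _)
           (cong₂ _++_ (bfilter-map (keepInner s) (_∷ʳ l0) W) (≡-trans (bfilter-++ (keepInner s) (map (_∷ʳ l1) W) _)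
             (cong₂ _++_ (bfilter-map (keepInner s) (_∷ʳ l1) W) (bfilter-map (keepInner s) (_∷ʳ l2) W))))))
  (++⁺ (map⁺ (_∷ʳ l0) (innerOf-copy s n l0)) (++⁺ (map⁺ (_∷ʳ l1) (innerOf-copy s n l1)) (map⁺ (_∷ʳ l2) (innerOf-copy s n l2)))))
  where
    W : List (Word n)
    W = allWords n

-- the bridge of label s joins two copies of Σ_n at their corners cor s n; bridgeL s is the last
-- letter of its lexicographically smaller endpoint
bridgeL : Gen → Letter
bridgeL ga = l0
bridgeL gb = l0
bridgeL gc = l1

bridge : ∀ n → Gen → Edge (suc n)
bridge n s = (s , cor s n ∷ʳ bridgeL s)

copies : ∀ {n} → List (Edge n) → List (Edge (suc n))
copies E = map (_∷ʳᵉ l0) E ++ (map (_∷ʳᵉ l1) E ++ map (_∷ʳᵉ l2) E)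

inner-suc : ∀ n → inner (suc n) ↭ bridge n ga ∷ bridge n gb ∷ bridge n gc ∷ copies (inner n)
inner-suc n =
  trans (++⁺ (labelled ga) (++⁺ (labelled gb) (++⁺ (labelled gc) refl)))
  (trans (bridges-first [ bridge n ga ] [ bridge n gb ] [ bridge n gc ] (m ga l0) (m ga l1) (m ga l2)
                  (m gb l0) (m gb l1) (m gb l2) (m gc l0) (m gc l1) (m gc l2))
         (↭-reflexive (cong (λ t → bridge n ga ∷ bridge n gb ∷ bridge n gc ∷ t)
           (sym (cong₂ _++_ (copy l0) (cong₂ _++_ (copy l1) (copy l2)))))))
  where
  m : Gen → Letter → List (Edge (suc n))
  m s x = map (s ,_) (map (_∷ʳ x) (innerOf s n))
  distribute : ∀ s (X Y Z : List (Word (suc n))) → map (s ,_) (X ++ (Y ++ Z)) ≡ map (s ,_) X ++ (map (s ,_) Y ++ map (s ,_) Z)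
  distribute s X Y Z = ≡-trans (List.map-++ (s ,_) X _) (cong (map (s ,_) X ++_) (List.map-++ (s ,_) Y Z))
  corner : Gen → Letter → List (Word n)
  corner s x = if bridgeAt s x then [ cor s n ] else []
  part : Gen → Letter → List (Edge (suc n))
  part s x = map (s ,_) (map (_∷ʳ x) (corner s x ++ innerOf s n))
  labelled : ∀ s → map (s ,_) (innerOf s (suc n)) ↭ part s l0 ++ (part s l1 ++ part s l2)
  labelled s = trans (map⁺ (s ,_) (innerOf-suc s n))
    (↭-reflexive (distribute s (map (_∷ʳ l0) (corner s l0 ++ innerOf s n)) (map (_∷ʳ l1) (corner s l1 ++ innerOf s n))
                                (map (_∷ʳ l2) (corner s l2 ++ innerOf s n))))
  copy : ∀ x → map (_∷ʳᵉ x) (inner n) ≡ m ga x ++ (m gb x ++ (m gc x ++ []))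
  copy x = ≡-trans (List.map-++ (_∷ʳᵉ x) (map (ga ,_) (innerOf ga n)) _) (cong₂ _++_ (relabel ga)
           (≡-trans (List.map-++ (_∷ʳᵉ x) (map (gb ,_) (innerOf gb n)) _) (cong₂ _++_ (relabel gb)
           (≡-trans (List.map-++ (_∷ʳᵉ x) (map (gc ,_) (innerOf gc n)) []) (cong₂ _++_ (relabel gc) refl)))))
    where
    relabel : ∀ s → map (_∷ʳᵉ x) (map (s ,_) (innerOf s n)) ≡ m s x
    relabel s = ≡-trans (sym (List.map-∘ (innerOf s n))) (List.map-∘ (innerOf s n))

need : Bool → ℕ
need z = 1 ∸ ind z

-- ek says the vertex is the corner k^n; zk says the loop at k^n is used
cornerReq : (z0 z1 z2 e0 e1 e2 : Bool) → ℕ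
cornerReq z0 z1 z2 e0 e1 e2 = if e0 then need z0 else if e1 then need z1 else if e2 then need z2 else 1

isCorner : ∀ {n} → Letter → Word n → Bool
isCorner {n} k v = eqW (replicate n k) v

-- the requirement on Σ_n left for the inner edges once the loops selected by z0 z1 z2 are used
req : ∀ {n} → (z0 z1 z2 : Bool) → Word n → ℕ
req z0 z1 z2 v = cornerReq z0 z1 z2 (isCorner l0 v) (isCorner l1 v) (isCorner l2 v)

-- in Σ_n with n ≥ 1 the three corners are distinct: a word is at most one of them
AtMostOne : Bool → Bool → Bool → Bool
AtMostOne true  true  _    = false
AtMostOne true  false true = false
AtMostOne false true  true = false
AtMostOne _     _     _    = true

corners-distinct : ∀ m (u : Word (suc m)) → AtMostOne (isCorner l0 u) (isCorner l1 u) (isCorner l2 u) ≡ true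
corners-distinct m (l0 ∷ u) with eqW (replicate m l0) u
... | true  = refl
... | false = refl
corners-distinct m (l1 ∷ u) with eqW (replicate m l1) u
... | true  = refl
... | false = refl
corners-distinct m (l2 ∷ u) with eqW (replicate m l2) u
... | true  = refl
... | false = refl

removeIf : ∀ {n} → Bool → Edge n → (Word n → ℕ) → Word n → ℕ
removeIf true  e r = r ⊝ e
removeIf false e r = r

removeIf-value : ∀ {n} β (e : Edge n) r v → removeIf β e r v ≡ r v ∸ ind (incident e v ∧ β)
removeIf-value true  e r v = cong (λ t → r v ∸ ind t) (sym (∧-identityʳ (incident e v)))
removeIf-value false e r v with incident e v
... | true  = refl
... | false = refl

afterBridges : ∀ {n} → (z0 z1 z2 βa βb βc : Bool) → Word (suc n) → ℕ
afterBridges {n} z0 z1 z2 βa βb βc =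
  removeIf βc (bridge n gc) (removeIf βb (bridge n gb) (removeIf βa (bridge n ga) (req z0 z1 z2)))

-- in the copy y of Σ_n, the corner k^n is the corner of Σ_(n+1) if k = y, and otherwise an
-- endpoint of the bridge of the label fixing k; its loop status is inherited accordingly
copyZ0 copyZ1 copyZ2 : (z βbridge : Bool) → Letter → Bool
copyZ0 z0 βc y = if eqL l0 y then z0 else βc
copyZ1 z1 βb y = if eqL l1 y then z1 else βb
copyZ2 z2 βa y = if eqL l2 y then z2 else βa

bridge-incident : ∀ n s y (u : Word n) → incident (bridge n s) (u ∷ʳ y) ≡
  ((eqW (cor s n) u ∧ eqL (bridgeL s) y) ∨ (eqW (cor s n) u ∧ eqL (actL s (bridgeL s)) y))
bridge-incident n s y u = ≡-trans (incident-eqW s (cor s n ∷ʳ bridgeL s) (u ∷ʳ y))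
  (cong₂ _∨_ (eqW-∷ʳ (bridgeL s) y (cor s n) u)
             (≡-trans (cong (λ t → eqW t (u ∷ʳ y)) (act-cor-∷ʳ s n (bridgeL s))) (eqW-∷ʳ (actL s (bridgeL s)) y (cor s n) u)))

afterBridgesAt : (z0 z1 z2 βa βb βc : Bool) → Letter → (e0 e1 e2 : Bool) → ℕ
afterBridgesAt z0 z1 z2 βa βb βc y e0 e1 e2 =
  ((cornerReq z0 z1 z2 (e0 ∧ eqL l0 y) (e1 ∧ eqL l1 y) (e2 ∧ eqL l2 y)
    ∸ ind (((e2 ∧ eqL l0 y) ∨ (e2 ∧ eqL l1 y)) ∧ βa))
    ∸ ind (((e1 ∧ eqL l0 y) ∨ (e1 ∧ eqL l2 y)) ∧ βb))
    ∸ ind (((e0 ∧ eqL l1 y) ∨ (e0 ∧ eqL l2 y)) ∧ βc)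

afterBridges-∷ʳ : ∀ n z0 z1 z2 βa βb βc y (u : Word n) → afterBridges z0 z1 z2 βa βb βc (u ∷ʳ y) ≡
  afterBridgesAt z0 z1 z2 βa βb βc y (isCorner l0 u) (isCorner l1 u) (isCorner l2 u)
afterBridges-∷ʳ n z0 z1 z2 βa βb βc y u
  rewrite removeIf-value βc (bridge n gc) (removeIf βb (bridge n gb) (removeIf βa (bridge n ga) (req z0 z1 z2))) (u ∷ʳ y)
        | removeIf-value βb (bridge n gb) (removeIf βa (bridge n ga) (req z0 z1 z2)) (u ∷ʳ y)
        | removeIf-value βa (bridge n ga) (req z0 z1 z2) (u ∷ʳ y)
        | eqW-replicate-∷ʳ n l0 y u | eqW-replicate-∷ʳ n l1 y u | eqW-replicate-∷ʳ n l2 y u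
        | bridge-incident n ga y u | bridge-incident n gb y u | bridge-incident n gc y u = refl

afterBridgesAt-copy : ∀ z0 z1 z2 βa βb βc y e0 e1 e2 → AtMostOne e0 e1 e2 ≡ true →
  afterBridgesAt z0 z1 z2 βa βb βc y e0 e1 e2 ≡ cornerReq (copyZ0 z0 βc y) (copyZ1 z1 βb y) (copyZ2 z2 βa y) e0 e1 e2
afterBridgesAt-copy z0 z1 z2 βa βb βc y  true  true  e2    ()
afterBridgesAt-copy z0 z1 z2 βa βb βc y  true  false true  ()
afterBridgesAt-copy z0 z1 z2 βa βb βc y  false true  true  ()
afterBridgesAt-copy z0 z1 z2 βa βb βc l0 false false false _ = refl
afterBridgesAt-copy z0 z1 z2 βa βb βc l1 false false false _ = refl
afterBridgesAt-copy z0 z1 z2 βa βb βc l2 false false false _ = refl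
afterBridgesAt-copy z0 z1 z2 βa βb βc l0 true  false false _ = refl
afterBridgesAt-copy z0 z1 z2 βa βb βc l1 true  false false _ = refl
afterBridgesAt-copy z0 z1 z2 βa βb βc l2 true  false false _ = refl
afterBridgesAt-copy z0 z1 z2 βa βb βc l0 false true  false _ = refl
afterBridgesAt-copy z0 z1 z2 βa βb βc l1 false true  false _ = refl
afterBridgesAt-copy z0 z1 z2 βa βb βc l2 false true  false _ = refl
afterBridgesAt-copy z0 z1 z2 βa βb βc l0 false false true  _ = refl
afterBridgesAt-copy z0 z1 z2 βa βb βc l1 false false true  _ = refl
afterBridgesAt-copy z0 z1 z2 βa βb βc l2 false false true  _ = refl

bridgesFitAt : ∀ z0 z1 z2 βa βb y e0 e1 e2 → AtMostOne e0 e1 e2 ≡ true →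
  (not ((e2 ∧ eqL l0 y) ∨ (e2 ∧ eqL l1 y)) ∨ pos (afterBridgesAt z0 z1 z2 false false false y e0 e1 e2)) ≡ true ×
  (not ((e1 ∧ eqL l0 y) ∨ (e1 ∧ eqL l2 y)) ∨ pos (afterBridgesAt z0 z1 z2 βa false false y e0 e1 e2)) ≡ true ×
  (not ((e0 ∧ eqL l1 y) ∨ (e0 ∧ eqL l2 y)) ∨ pos (afterBridgesAt z0 z1 z2 βa βb false y e0 e1 e2)) ≡ true
bridgesFitAt z0 z1 z2 βa βb y  true  true  e2    ()
bridgesFitAt z0 z1 z2 βa βb y  true  false true  ()
bridgesFitAt z0 z1 z2 βa βb y  false true  true  ()
bridgesFitAt z0 z1 z2 βa βb l0 false false false _ = refl , refl , refl
bridgesFitAt z0 z1 z2 βa βb l1 false false false _ = refl , refl , refl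
bridgesFitAt z0 z1 z2 βa βb l2 false false false _ = refl , refl , refl
bridgesFitAt z0 z1 z2 βa βb l0 true  false false _ = refl , refl , refl
bridgesFitAt z0 z1 z2 βa βb l1 true  false false _ = refl , refl , refl
bridgesFitAt z0 z1 z2 βa βb l2 true  false false _ = refl , refl , refl
bridgesFitAt z0 z1 z2 βa βb l0 false true  false _ = refl , refl , refl
bridgesFitAt z0 z1 z2 βa βb l1 false true  false _ = refl , refl , refl
bridgesFitAt z0 z1 z2 βa βb l2 false true  false _ = refl , refl , refl
bridgesFitAt z0 z1 z2 βa βb l0 false false true  _ = refl , refl , refl
bridgesFitAt z0 z1 z2 βa βb l1 false false true  _ = refl , refl , refl
bridgesFitAt z0 z1 z2 βa βb l2 false false true  _ = refl , refl , refl

fits-by-copies : ∀ {n} (e : Edge (suc n)) r →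
  (∀ y u → (not (incident e (u ∷ʳ y)) ∨ pos (r (u ∷ʳ y))) ≡ true) → fits e r ≡ true
fits-by-copies {n} e r h = allB-intro _ (allWords (suc n)) λ v → at v (initLast v)
  where
  at : ∀ v → ∃₂ (λ u y → v ≡ u ∷ʳ y) → (not (incident e v) ∨ pos (r v)) ≡ true
  at .(u ∷ʳ y) (u , y , refl) = h y u

module _ (m : ℕ) (z0 z1 z2 : Bool) where
  private
    n : ℕ
    n = suc m

  fits-bridge-a : fits (bridge n ga) (afterBridges z0 z1 z2 false false false) ≡ true
  fits-bridge-a = fits-by-copies (bridge n ga) (afterBridges z0 z1 z2 false false false) λ y u →
    ≡-trans (cong₂ (λ i t → not i ∨ pos t) (bridge-incident n ga y u) (afterBridges-∷ʳ n z0 z1 z2 false false false y u))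
            (proj₁ (bridgesFitAt z0 z1 z2 false false y _ _ _ (corners-distinct m u)))

  fits-bridge-b : ∀ βa → fits (bridge n gb) (afterBridges z0 z1 z2 βa false false) ≡ true
  fits-bridge-b βa = fits-by-copies (bridge n gb) (afterBridges z0 z1 z2 βa false false) λ y u →
    ≡-trans (cong₂ (λ i t → not i ∨ pos t) (bridge-incident n gb y u) (afterBridges-∷ʳ n z0 z1 z2 βa false false y u))
            (proj₁ (proj₂ (bridgesFitAt z0 z1 z2 βa false y _ _ _ (corners-distinct m u))))

  fits-bridge-c : ∀ βa βb → fits (bridge n gc) (afterBridges z0 z1 z2 βa βb false) ≡ true
  fits-bridge-c βa βb = fits-by-copies (bridge n gc) (afterBridges z0 z1 z2 βa βb false) λ y u →
    ≡-trans (cong₂ (λ i t → not i ∨ pos t) (bridge-incident n gc y u) (afterBridges-∷ʳ n z0 z1 z2 βa βb false y u))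
            (proj₂ (proj₂ (bridgesFitAt z0 z1 z2 βa βb y _ _ _ (corners-distinct m u))))

module Reduced (a b c : ℚ) where
  open PartitionFunction a b c
  open Copies a b c

  -- F z n: the partition function of the coverings of the inner edges of Σ_n meeting req z,
  -- i.e. of the dimer coverings of Σ_n whose set of loops is the one selected by z
  F : (z0 z1 z2 : Bool) → ℕ → ℚ
  F z0 z1 z2 n = Z (inner n) (req z0 z1 z2)

  T : (z0 z1 z2 βa βb βc : Bool) → ℕ → ℚ
  T z0 z1 z2 βa βb βc n =
    F (copyZ0 z0 βc l0) (copyZ1 z1 βb l0) (copyZ2 z2 βa l0) n *
    F (copyZ0 z0 βc l1) (copyZ1 z1 βb l1) (copyZ2 z2 βa l1) n *
    F (copyZ0 z0 βc l2) (copyZ1 z1 βb l2) (copyZ2 z2 βa l2) n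

  bridgeSum : (Bool → Bool → Bool → ℚ) → ℚ
  bridgeSum g =
    a * (b * (c * g true true true + g true true false) + (c * g true false true + g true false false)) +
        (b * (c * g false true true + g false true false) + (c * g false false true + g false false false))

  bridgeSum-cong : ∀ {g h} → (∀ βa βb βc → g βa βb βc ≡ h βa βb βc) → bridgeSum g ≡ bridgeSum h
  bridgeSum-cong {g} {h} e rewrite e true true true | e true true false | e true false true | e true false false
    | e false true true | e false true false | e false false true | e false false false = refl

  Z-cons-fits : ∀ {n} (e : Edge n) E r → fits e r ≡ true → Z (e ∷ E) r ≡ w e * Z E (r ⊝ e) + Z E r
  Z-cons-fits e E r fit = ≡-trans (Z-cons e E r) (cong (λ d → (if d then w e * Z E (r ⊝ e) else 0ℚ) + Z E r) fit)

  Z-copies-afterBridges : ∀ m z0 z1 z2 βa βb βc →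
    Z (copies (inner (suc m))) (afterBridges z0 z1 z2 βa βb βc) ≡ T z0 z1 z2 βa βb βc (suc m)
  Z-copies-afterBridges m z0 z1 z2 βa βb βc =
    ≡-trans (Z-copies (inner n) (inner n) (inner n) (inner-away n) (inner-away n) (inner-away n) _)
            (cong₂ _*_ (cong₂ _*_ (in-copy l0) (in-copy l1)) (in-copy l2))
    where
    n : ℕ
    n = suc m
    in-copy : ∀ y → Z (inner n) (afterBridges z0 z1 z2 βa βb βc ↾ y) ≡ F (copyZ0 z0 βc y) (copyZ1 z1 βb y) (copyZ2 z2 βa y) n
    in-copy y = Z-cong (inner n) λ u → ≡-trans (afterBridges-∷ʳ n z0 z1 z2 βa βb βc y u)
                  (afterBridgesAt-copy z0 z1 z2 βa βb βc y _ _ _ (corners-distinct m u))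

  F-suc : ∀ m z0 z1 z2 → F z0 z1 z2 (suc (suc m)) ≡ bridgeSum (λ βa βb βc → T z0 z1 z2 βa βb βc (suc m))
  F-suc m z0 z1 z2 = begin
    F z0 z1 z2 (suc n)                                        ≡⟨ Z-perm (req z0 z1 z2) (inner-suc n) ⟩
    Z (bridge n ga ∷ bridge n gb ∷ bridge n gc ∷ J) (req z0 z1 z2)  ≡⟨ use-a ⟩
    bridgeSum leaf                                             ≡⟨ bridgeSum-cong (Z-copies-afterBridges m z0 z1 z2) ⟩
    bridgeSum (λ βa βb βc → T z0 z1 z2 βa βb βc n)             ∎
    where
    open ≡-Reasoning
    n : ℕ
    n = suc m
    J : List (Edge (suc n))
    J = copies (inner n)
    leaf : Bool → Bool → Bool → ℚ
    leaf βa βb βc = Z J (afterBridges z0 z1 z2 βa βb βc)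
    use-c : ∀ βa βb → Z (bridge n gc ∷ J) (afterBridges z0 z1 z2 βa βb false) ≡ c * leaf βa βb true + leaf βa βb false
    use-c βa βb = Z-cons-fits (bridge n gc) J _ (fits-bridge-c m z0 z1 z2 βa βb)
    use-b : ∀ βa → Z (bridge n gb ∷ bridge n gc ∷ J) (afterBridges z0 z1 z2 βa false false) ≡
      b * (c * leaf βa true true + leaf βa true false) + (c * leaf βa false true + leaf βa false false)
    use-b βa = ≡-trans (Z-cons-fits (bridge n gb) (bridge n gc ∷ J) (afterBridges z0 z1 z2 βa false false) (fits-bridge-b m z0 z1 z2 βa))
                       (cong₂ (λ p q → b * p + q) (use-c βa true) (use-c βa false))
    use-a : Z (bridge n ga ∷ bridge n gb ∷ bridge n gc ∷ J) (req z0 z1 z2) ≡ bridgeSum leaf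
    use-a = ≡-trans (Z-cons-fits (bridge n ga) (bridge n gb ∷ bridge n gc ∷ J) (req z0 z1 z2) (fits-bridge-a m z0 z1 z2))
                    (cong₂ (λ p q → a * p + q) (use-b true) (use-b false))

coveredCorner : (z0 z1 z2 e0 e1 e2 : Bool) → Bool
coveredCorner z0 z1 z2 e0 e1 e2 = if e0 then z0 else if e1 then z1 else if e2 then z2 else false

-- every vertex is covered once: by a loop or by the inner edges
cornerReq-complement : ∀ z0 z1 z2 e0 e1 e2 → cornerReq z0 z1 z2 e0 e1 e2 ℕ.+ ind (coveredCorner z0 z1 z2 e0 e1 e2) ≡ 1
cornerReq-complement z0 z1 z2 true  e1    e2    with z0
... | true  = refl
... | false = refl
cornerReq-complement z0 z1 z2 false true  e2    with z1
... | true  = refl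
... | false = refl
cornerReq-complement z0 z1 z2 false false true  with z2
... | true  = refl
... | false = refl
cornerReq-complement z0 z1 z2 false false false = refl

sumℕ-complement : ∀ {A : Set} (r : A → ℕ) (h : A → Bool) → (∀ v → r v ℕ.+ ind (h v) ≡ 1) → ∀ L →
  sumℕ r L ℕ.+ count h L ≡ length L
sumℕ-complement r h comp []      = refl
sumℕ-complement r h comp (v ∷ L) = step (r v) (h v) (comp v) (sumℕ-complement r h comp L)
  where
  step : ∀ x i {S K N} → x ℕ.+ ind i ≡ 1 → S ℕ.+ K ≡ N → (x ℕ.+ S) ℕ.+ (if i then suc K else K) ≡ suc N
  step zero    true  {S} {K} _  refl = ℕₚ.+-suc S K
  step zero    false         () _
  step (suc zero) false {S} {K} _ refl = refl
  step (suc zero) true  () _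
  step (suc (suc x)) i ()

count-covered : ∀ m z0 z1 z2 →
  count (λ v → coveredCorner z0 z1 z2 (isCorner l0 v) (isCorner l1 v) (isCorner l2 v)) (allWords (suc m))
  ≡ ind z0 ℕ.+ (ind z1 ℕ.+ ind z2)
count-covered m z0 z1 z2 =
  ≡-trans (count-cong (λ v → as-∨ _ _ _ (corners-distinct m v)) W)
  (≡-trans (count-∨ _ _ (λ v → disjoint₀ _ _ _ (corners-distinct m v)) W)
  (cong₂ ℕ._+_ (at-corner (replicate (suc m) l0) z0)
    (≡-trans (count-∨ _ _ (λ v → disjoint₁₂ _ _ _ (corners-distinct m v)) W)
      (cong₂ ℕ._+_ (at-corner (replicate (suc m) l1) z1) (at-corner (replicate (suc m) l2) z2)))))
  where
  W : List (Word (suc m))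
  W = allWords (suc m)
  as-∨ : ∀ e0 e1 e2 → AtMostOne e0 e1 e2 ≡ true →
    coveredCorner z0 z1 z2 e0 e1 e2 ≡ ((e0 ∧ z0) ∨ ((e1 ∧ z1) ∨ (e2 ∧ z2)))
  as-∨ true  true  e2    ()
  as-∨ true  false true  ()
  as-∨ false true  true  ()
  as-∨ false false false _ = refl
  as-∨ true  false false _ = sym (∨-identityʳ z0)
  as-∨ false true  false _ = sym (∨-identityʳ z1)
  as-∨ false false true  _ = refl
  disjoint₀ : ∀ e0 e1 e2 → AtMostOne e0 e1 e2 ≡ true → ((e0 ∧ z0) ∧ ((e1 ∧ z1) ∨ (e2 ∧ z2))) ≡ false
  disjoint₀ true  true  e2    ()
  disjoint₀ true  false true  ()
  disjoint₀ false true  true  ()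
  disjoint₀ false e1    e2    _ = refl
  disjoint₀ true  false false _ = ∧-zeroʳ z0
  disjoint₁₂ : ∀ e0 e1 e2 → AtMostOne e0 e1 e2 ≡ true → ((e1 ∧ z1) ∧ (e2 ∧ z2)) ≡ false
  disjoint₁₂ true  true  e2    ()
  disjoint₁₂ true  false true  ()
  disjoint₁₂ false true  true  ()
  disjoint₁₂ e0    false e2    _ = refl
  disjoint₁₂ false true  false _ = ∧-zeroʳ z1
  at-corner : (u : Word (suc m)) → ∀ z → count (λ v → eqW u v ∧ z) W ≡ ind z
  at-corner u true  = ≡-trans (count-cong (λ v → ∧-identityʳ (eqW u v)) W) (allWords-unique′ u)
  at-corner u false = ≡-trans (count-cong (λ v → ∧-zeroʳ (eqW u v)) W) (count-false W)

-- Σ_n has 3^n vertices, an odd number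
odd-vertices : ∀ n → odd (length (allWords n)) ≡ true
odd-vertices zero    = refl
odd-vertices (suc n) = ≡-trans (cong odd three-copies) (odd-triple (length W) (odd-vertices n))
  where
  W : List (Word n)
  W = allWords n
  three-copies : length (allWords (suc n)) ≡ length W ℕ.+ (length W ℕ.+ (length W ℕ.+ 0))
  three-copies = ≡-trans (List.length-++ (map (l0 ∷_) W)) (cong₂ ℕ._+_ (List.length-map (l0 ∷_) W)
    (≡-trans (List.length-++ (map (l1 ∷_) W)) (cong₂ ℕ._+_ (List.length-map (l1 ∷_) W)
    (≡-trans (List.length-++ (map (l2 ∷_) W)) (cong₂ ℕ._+_ (List.length-map (l2 ∷_) W) refl)))))
  odd-triple : ∀ L → odd L ≡ true → odd (L ℕ.+ (L ℕ.+ (L ℕ.+ 0))) ≡ true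
  odd-triple L h rewrite odd-+ L (L ℕ.+ (L ℕ.+ 0)) | odd-+ L (L ℕ.+ 0) | odd-+ L 0 | h = refl

odd-total-req : ∀ m z0 z1 z2 → odd (ind z0 ℕ.+ (ind z1 ℕ.+ ind z2)) ≡ false → odd (total (req {suc m} z0 z1 z2)) ≡ true
odd-total-req m z0 z1 z2 h = from-xor (odd (total (req {suc m} z0 z1 z2))) _
  (≡-trans (sym (odd-+ (total (req {suc m} z0 z1 z2)) _))
    (≡-trans (cong odd (sumℕ-complement (req z0 z1 z2) _ (λ v → cornerReq-complement z0 z1 z2 (isCorner l0 v) (isCorner l1 v) (isCorner l2 v)) (allWords (suc m))))
      (odd-vertices (suc m))))
  (≡-trans (cong odd (count-covered m z0 z1 z2)) h)
  where
  from-xor : ∀ x y → x xor y ≡ true → y ≡ false → x ≡ true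
  from-xor true false _ _ = refl

module Vanishing (a b c : ℚ) where
  open Reduced a b c
  open Parity a b c

  -- a dimer covering of Σ_n uses an odd number of loops
  F-even : ∀ m z0 z1 z2 → odd (ind z0 ℕ.+ (ind z1 ℕ.+ ind z2)) ≡ false → F z0 z1 z2 (suc m) ≡ 0ℚ
  F-even m z0 z1 z2 h = Z-odd (inner (suc m))
    (All-map (λ {e} away → λ loop → away (act-fixed (label e) (proj₂ e) loop)) (inner-away (suc m)))
    (req z0 z1 z2) (odd-total-req m z0 z1 z2 h)

withIf : ∀ {A : Set} → Bool → A → List A → List A
withIf true  x C = x ∷ C
withIf false x C = C

scaleIf : Bool → ℚ → ℚ → ℚ
scaleIf true  k x = k * x
scaleIf false k x = x

withLoops : ∀ {n} → (p0 p1 p2 : Bool) → List (Edge n) → List (Edge n)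
withLoops {n} p0 p1 p2 C = withIf p2 (loop ga n) (withIf p1 (loop gb n) (withIf p0 (loop gc n) C))

matches : CovType → (p0 p1 p2 : Bool) → Bool
matches I   p0 p1 p2 = p0 ∧ p1 ∧ p2
matches II  p0 p1 p2 = p0 ∧ not p1 ∧ not p2
matches III p0 p1 p2 = not p0 ∧ p1 ∧ not p2
matches IV  p0 p1 p2 = not p0 ∧ not p1 ∧ p2

==g-refl : ∀ s → (s ==g s) ≡ true
==g-refl ga = refl
==g-refl gb = refl
==g-refl gc = refl

memE-hit : ∀ {n} s p (X : List (Edge n)) → memE (loop s n) (withIf p (loop s n) X) ≡ p ∨ memE (loop s n) X
memE-hit {n} s true  X rewrite ==g-refl s | ==w-eqW (cor s n) (cor s n) | eqW-refl (cor s n) = refl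
memE-hit     s false X = refl

memE-skip : ∀ {n} s t → (s ==g t) ≡ false → ∀ p (X : List (Edge n)) → memE (loop s n) (withIf p (loop t n) X) ≡ memE (loop s n) X
memE-skip s t s≠t true  X rewrite s≠t = refl
memE-skip s t s≠t false X = refl

loop≠inner : ∀ {n} s t (u : Word n) → u ≢ cor t n → ((s ==g t) ∧ (cor s n ==w u)) ≡ false
loop≠inner {n} ga ga u away = ≡-trans (==w-eqW (cor ga n) u) (eqW-≢ (cor ga n) u (λ e → away (sym e)))
loop≠inner {n} gb gb u away = ≡-trans (==w-eqW (cor gb n) u) (eqW-≢ (cor gb n) u (λ e → away (sym e)))
loop≠inner {n} gc gc u away = ≡-trans (==w-eqW (cor gc n) u) (eqW-≢ (cor gc n) u (λ e → away (sym e)))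
loop≠inner ga gb u away = refl
loop≠inner ga gc u away = refl
loop≠inner gb ga u away = refl
loop≠inner gb gc u away = refl
loop≠inner gc ga u away = refl
loop≠inner gc gb u away = refl

memE-inner : ∀ {n} s (C : List (Edge n)) → All AwayFromCorner C → memE (loop s n) C ≡ false
memE-inner s []            []             = refl
memE-inner s ((t , u) ∷ C) (away ∷ aways) rewrite memE-inner s C aways =
  ≡-trans (∨-identityʳ _) (loop≠inner s t u away)

hasType-withLoops : ∀ {n} T p0 p1 p2 (C : List (Edge n)) → All AwayFromCorner C →
  hasType T (withLoops p0 p1 p2 C) ≡ matches T p0 p1 p2
hasType-withLoops {n} T p0 p1 p2 C aways = by-type T
  where
  at0 : memE (loop0 n) (withLoops p0 p1 p2 C) ≡ p0
  at0 rewrite memE-skip gc ga refl p2 (withIf p1 (loop gb n) (withIf p0 (loop gc n) C))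
            | memE-skip gc gb refl p1 (withIf p0 (loop gc n) C) | memE-hit gc p0 C | memE-inner gc C aways = ∨-identityʳ p0
  at1 : memE (loop1 n) (withLoops p0 p1 p2 C) ≡ p1
  at1 rewrite memE-skip gb ga refl p2 (withIf p1 (loop gb n) (withIf p0 (loop gc n) C))
            | memE-hit gb p1 (withIf p0 (loop gc n) C) | memE-skip gb gc refl p0 C | memE-inner gb C aways = ∨-identityʳ p1
  at2 : memE (loop2 n) (withLoops p0 p1 p2 C) ≡ p2
  at2 rewrite memE-hit ga p2 (withIf p1 (loop gb n) (withIf p0 (loop gc n) C))
            | memE-skip ga gb refl p1 (withIf p0 (loop gc n) C) | memE-skip ga gc refl p0 C | memE-inner ga C aways = ∨-identityʳ p2
  by-type : ∀ T → hasType T (withLoops p0 p1 p2 C) ≡ matches T p0 p1 p2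
  by-type I   rewrite at0 | at1 | at2 = refl
  by-type II  rewrite at0 | at1 | at2 = refl
  by-type III rewrite at0 | at1 | at2 = refl
  by-type IV  rewrite at0 | at1 | at2 = refl

addIf : Bool → ℕ → ℕ
addIf i k = if i then suc k else k

count-withIf : ∀ {A : Set} (P : A → Bool) p x C → count P (withIf p x C) ≡ addIf (P x ∧ p) (count P C)
count-withIf P true  x C = cong (λ i → addIf i (count P C)) (sym (∧-identityʳ (P x)))
count-withIf P false x C = cong (λ i → addIf i (count P C)) (sym (∧-zeroʳ (P x)))

incident-loop : ∀ {n} s (v : Word n) → incident (loop s n) v ≡ eqW (cor s n) v
incident-loop {n} s v rewrite act-cor s n | ==w-eqW (cor s n) v with eqW (cor s n) v
... | true  = refl
... | false = refl

dimer-at : ∀ p0 p1 p2 e0 e1 e2 K → AtMostOne e0 e1 e2 ≡ true →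
  (addIf (e2 ∧ p2) (addIf (e1 ∧ p1) (addIf (e0 ∧ p0) K)) ℕ.≡ᵇ 1) ≡ (K ℕ.≡ᵇ cornerReq p0 p1 p2 e0 e1 e2)
dimer-at p0    p1    p2    true  true  e2    K ()
dimer-at p0    p1    p2    true  false true  K ()
dimer-at p0    p1    p2    false true  true  K ()
dimer-at p0    p1    p2    false false false K _ = refl
dimer-at true  p1    p2    true  false false K _ = refl
dimer-at false p1    p2    true  false false K _ = refl
dimer-at p0    true  p2    false true  false K _ = refl
dimer-at p0    false p2    false true  false K _ = refl
dimer-at p0    p1    true  false false true  K _ = refl
dimer-at p0    p1    false false false true  K _ = refl

isDimer-withLoops : ∀ m p0 p1 p2 (C : List (Edge (suc m))) → isDimer (withLoops p0 p1 p2 C) ≡ covers C (req p0 p1 p2)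
isDimer-withLoops m p0 p1 p2 C = allB-ext pointwise (allWords (suc m))
  where
  n : ℕ
  n = suc m
  P : Word n → Edge n → Bool
  P v e = incident e v
  pointwise : ∀ v → (count (P v) (withLoops p0 p1 p2 C) ℕ.≡ᵇ 1) ≡ (count (P v) C ℕ.≡ᵇ req p0 p1 p2 v)
  pointwise v rewrite count-withIf (P v) p2 (loop ga n) (withIf p1 (loop gb n) (withIf p0 (loop gc n) C))
    | count-withIf (P v) p1 (loop gb n) (withIf p0 (loop gc n) C) | count-withIf (P v) p0 (loop gc n) C
    | incident-loop ga v | incident-loop gb v | incident-loop gc v =
    dimer-at p0 p1 p2 _ _ _ (count (P v) C) (corners-distinct m v)

memE-perm : ∀ {n} (e : Edge n) {C C' : List (Edge n)} → C ↭ C' → memE e C ≡ memE e C'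
memE-perm e refl         = refl
memE-perm e (prep x q)   = cong ((e ==e x) ∨_) (memE-perm e q)
memE-perm e (swap x y q) rewrite memE-perm e q = ≡-trans (sym (∨-assoc (e ==e x) (e ==e y) _))
  (≡-trans (cong (_∨ _) (∨-comm (e ==e x) (e ==e y))) (∨-assoc (e ==e y) (e ==e x) _))
memE-perm e (trans q q') = ≡-trans (memE-perm e q) (memE-perm e q')

hasType-perm : ∀ {n} T {C C' : List (Edge n)} → C ↭ C' → hasType T C ≡ hasType T C'
hasType-perm {n} I   q rewrite memE-perm (loop0 n) q | memE-perm (loop1 n) q | memE-perm (loop2 n) q = refl
hasType-perm {n} II  q rewrite memE-perm (loop0 n) q | memE-perm (loop1 n) q | memE-perm (loop2 n) q = refl
hasType-perm {n} III q rewrite memE-perm (loop0 n) q | memE-perm (loop1 n) q | memE-perm (loop2 n) q = refl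
hasType-perm {n} IV  q rewrite memE-perm (loop0 n) q | memE-perm (loop1 n) q | memE-perm (loop2 n) q = refl

module Loops (a b c : ℚ) where
  open PartitionFunction a b c

  weight-withLoops : ∀ {n} p0 p1 p2 (C : List (Edge n)) → W (withLoops p0 p1 p2 C) ≡ scaleIf p2 a (scaleIf p1 b (scaleIf p0 c (W C)))
  weight-withLoops p0 p1 p2 C = ≡-trans (step p2 (loop ga _) _) (cong (scaleIf p2 a)
                                  (≡-trans (step p1 (loop gb _) _) (cong (scaleIf p1 b) (step p0 (loop gc _) C))))
    where
    step : ∀ {n} p (x : Edge n) X → W (withIf p x X) ≡ scaleIf p (w x) (W X)
    step true  x X = refl
    step false x X = refl

  scaleIf-if : ∀ d p k x → (if d then scaleIf p k x else 0ℚ) ≡ scaleIf p k (if d then x else 0ℚ)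
  scaleIf-if d true  k x = if-scale d k x
  scaleIf-if d false k x = refl

  Σsub-scaleIf : ∀ {n} p k (f : List (Edge n) → ℚ) E → Σsub (λ C → scaleIf p k (f C)) E ≡ scaleIf p k (Σsub f E)
  Σsub-scaleIf true  k f E = Σsub-scale k f E
  Σsub-scaleIf false k f E = refl

  typeTerm : ∀ {n} → CovType → List (Edge n) → ℚ
  typeTerm T C = if isDimer C ∧ hasType T C then W C else 0ℚ

  typeTerm-withLoops : ∀ m T p0 p1 p2 (C : List (Edge (suc m))) → All AwayFromCorner C →
    typeTerm T (withLoops p0 p1 p2 C) ≡
    (if matches T p0 p1 p2 then scaleIf p2 a (scaleIf p1 b (scaleIf p0 c (Zterm (req p0 p1 p2) C))) else 0ℚ)
  typeTerm-withLoops m T p0 p1 p2 C aways rewrite isDimer-withLoops m p0 p1 p2 C | hasType-withLoops T p0 p1 p2 C aways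
    | weight-withLoops p0 p1 p2 C with matches T p0 p1 p2
  ... | true  rewrite ∧-identityʳ (covers C (req p0 p1 p2)) =
    ≡-trans (scaleIf-if _ p2 a _) (cong (scaleIf p2 a) (≡-trans (scaleIf-if _ p1 b _) (cong (scaleIf p1 b) (scaleIf-if _ p0 c _))))
  ... | false rewrite ∧-zeroʳ (covers C (req p0 p1 p2)) = refl

  Σ𝔹 : (Bool → ℚ) → ℚ
  Σ𝔹 g = g true + g false

  Σsub-three : ∀ {A : Set} (f : List A → ℚ) x y z E → Σsub f (x ∷ y ∷ z ∷ E) ≡
    Σ𝔹 λ p2 → Σ𝔹 λ p1 → Σ𝔹 λ p0 → Σsub (λ C → f (withIf p2 x (withIf p1 y (withIf p0 z C)))) E
  Σsub-three f x y z E = ≡-trans (Σsub-cons f x (y ∷ z ∷ E)) (cong₂ _+_ (two (λ C → f (x ∷ C))) (two f))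
    where
    two : ∀ g → Σsub g (y ∷ z ∷ E) ≡ Σ𝔹 λ p1 → Σ𝔹 λ p0 → Σsub (λ C → g (withIf p1 y (withIf p0 z C))) E
    two g = ≡-trans (Σsub-cons g y (z ∷ E)) (cong₂ _+_ (Σsub-cons (λ C → g (y ∷ C)) z E) (Σsub-cons g z E))

  typeTerm-perm : ∀ {n} T → PermInvariant (typeTerm {n} T)
  typeTerm-perm T q = cong₂ (λ d x → if d then x else 0ℚ) (cong₂ _∧_ (covers-perm (λ _ → 1) q) (hasType-perm T q)) (W-perm q)

  Σ𝔹³-cong : ∀ {g h : Bool → Bool → Bool → ℚ} → (∀ p2 p1 p0 → g p2 p1 p0 ≡ h p2 p1 p0) →
    (Σ𝔹 λ p2 → Σ𝔹 λ p1 → Σ𝔹 λ p0 → g p2 p1 p0) ≡ (Σ𝔹 λ p2 → Σ𝔹 λ p1 → Σ𝔹 λ p0 → h p2 p1 p0)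
  Σ𝔹³-cong {g} {h} e = cong₂ _+_ (level true) (level false)
    where
    level : ∀ p2 → (Σ𝔹 λ p1 → Σ𝔹 λ p0 → g p2 p1 p0) ≡ (Σ𝔹 λ p1 → Σ𝔹 λ p0 → h p2 p1 p0)
    level p2 = cong₂ _+_ (cong₂ _+_ (e p2 true true) (e p2 true false)) (cong₂ _+_ (e p2 false true) (e p2 false false))

  open Reduced a b c using (F)

  Σsub-inner : ∀ m T p0 p1 p2 → Σsub (λ C → typeTerm T (withLoops p0 p1 p2 C)) (inner (suc m)) ≡
    (if matches T p0 p1 p2 then scaleIf p2 a (scaleIf p1 b (scaleIf p0 c (F p0 p1 p2 (suc m)))) else 0ℚ)
  Σsub-inner m T p0 p1 p2 =
    ≡-trans (Σsub-congᴬ AwayFromCorner (inner n) (inner-away n) (typeTerm-withLoops m T p0 p1 p2)) (by-match (matches T p0 p1 p2))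
    where
    n : ℕ
    n = suc m
    by-match : ∀ d → Σsub (λ C → if d then scaleIf p2 a (scaleIf p1 b (scaleIf p0 c (Zterm (req p0 p1 p2) C))) else 0ℚ) (inner n)
                   ≡ (if d then scaleIf p2 a (scaleIf p1 b (scaleIf p0 c (F p0 p1 p2 n))) else 0ℚ)
    by-match true  = ≡-trans (Σsub-scaleIf p2 a _ (inner n)) (cong (scaleIf p2 a)
                     (≡-trans (Σsub-scaleIf p1 b _ (inner n)) (cong (scaleIf p1 b) (Σsub-scaleIf p0 c _ (inner n)))))
    by-match false = Σsub-zero (inner n)

  Φ-by-loops : ∀ m T → Φ T a b c (suc m) ≡
    (Σ𝔹 λ p2 → Σ𝔹 λ p1 → Σ𝔹 λ p0 → if matches T p0 p1 p2 then scaleIf p2 a (scaleIf p1 b (scaleIf p0 c (F p0 p1 p2 (suc m)))) else 0ℚ)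
  Φ-by-loops m T = begin
    Φ T a b c n                                                 ≡⟨ sumℚ-bfilter W (λ C → isDimer C ∧ hasType T C) (subsets (edges n)) ⟩
    Σsub (typeTerm T) (edges n)                                 ≡⟨ Σsub-perm (typeTerm T) (typeTerm-perm T) (edges-loops n) ⟩
    Σsub (typeTerm T) (loop ga n ∷ loop gb n ∷ loop gc n ∷ inner n) ≡⟨ Σsub-three (typeTerm T) _ _ _ (inner n) ⟩
    _                                                           ≡⟨ Σ𝔹³-cong (λ p2 p1 p0 → Σsub-inner m T p0 p1 p2) ⟩
    _                                                           ∎
    where
    open ≡-Reasoning
    n : ℕ
    n = suc m

  -- only one of the eight sets of loops matches a given type
  Φ-I : ∀ m → Φ I a b c (suc m) ≡ a * (b * (c * F true true true (suc m)))
  Φ-I m = ≡-trans (Φ-by-loops m I) (≡-trans (+-identityʳ _) (≡-trans (+-identityʳ _) (+-identityʳ _)))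

  Φ-II : ∀ m → Φ II a b c (suc m) ≡ c * F true false false (suc m)
  Φ-II m = ≡-trans (Φ-by-loops m II) (≡-trans (+-identityˡ _) (≡-trans (+-identityˡ _) (+-identityʳ _)))

  Φ-III : ∀ m → Φ III a b c (suc m) ≡ b * F false true false (suc m)
  Φ-III m = ≡-trans (Φ-by-loops m III) (≡-trans (+-identityˡ _) (≡-trans (+-identityʳ _) (+-identityˡ _)))

  Φ-IV : ∀ m → Φ IV a b c (suc m) ≡ a * F false false true (suc m)
  Φ-IV m = ≡-trans (Φ-by-loops m IV) (≡-trans (+-identityʳ _) (≡-trans (+-identityˡ _) (+-identityˡ _)))

-- the eight bridge choices fall into four complementary pairs (bridgeSum unfolds to the left-hand side)
bridgeSum-pairs : ∀ (a b c g111 g110 g101 g100 g011 g010 g001 g000 : ℚ) →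
  a * (b * (c * g111 + g110) + (c * g101 + g100)) + (b * (c * g011 + g010) + (c * g001 + g000)) ≡
  (a * b * c * g111 + g000) + ((a * b * g110 + c * g001) + ((a * c * g101 + b * g010) + (b * c * g011 + a * g100)))
bridgeSum-pairs = solve-∀ ℚ-ring

pair-zero : ∀ k k' {x x'} → x ≡ 0ℚ → x' ≡ 0ℚ → k * x + k' * x' ≡ 0ℚ
pair-zero k k' refl refl rewrite *-zeroʳ k | *-zeroʳ k' = refl

pair-zero′ : ∀ k {x x'} → x ≡ 0ℚ → x' ≡ 0ℚ → k * x + x' ≡ 0ℚ
pair-zero′ k refl refl rewrite *-zeroʳ k = refl

only-1st : ∀ {p q r s} → q ≡ 0ℚ → r ≡ 0ℚ → s ≡ 0ℚ → p + (q + (r + s)) ≡ p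
only-1st {p} refl refl refl = +-identityʳ p

only-2nd : ∀ {p q r s} → p ≡ 0ℚ → r ≡ 0ℚ → s ≡ 0ℚ → p + (q + (r + s)) ≡ q
only-2nd {q = q} refl refl refl = ≡-trans (+-identityˡ (q + 0ℚ)) (+-identityʳ q)

only-3rd : ∀ {p q r s} → p ≡ 0ℚ → q ≡ 0ℚ → s ≡ 0ℚ → p + (q + (r + s)) ≡ r
only-3rd {r = r} refl refl refl = ≡-trans (+-identityˡ (0ℚ + (r + 0ℚ))) (≡-trans (+-identityˡ (r + 0ℚ)) (+-identityʳ r))

only-4th : ∀ {p q r s} → p ≡ 0ℚ → q ≡ 0ℚ → r ≡ 0ℚ → p + (q + (r + s)) ≡ s
only-4th {s = s} refl refl refl = ≡-trans (+-identityˡ (0ℚ + (0ℚ + s))) (≡-trans (+-identityˡ (0ℚ + s)) (+-identityˡ s))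

product-zero₀ : ∀ {x} y z → x ≡ 0ℚ → x * y * z ≡ 0ℚ
product-zero₀ y z refl = ≡-trans (cong (_* z) (*-zeroˡ y)) (*-zeroˡ z)

product-zero₁ : ∀ x {y} z → y ≡ 0ℚ → x * y * z ≡ 0ℚ
product-zero₁ x z refl = ≡-trans (cong (_* z) (*-zeroʳ x)) (*-zeroˡ z)

product-zero₂ : ∀ x y {z} → z ≡ 0ℚ → x * y * z ≡ 0ℚ
product-zero₂ x y refl = *-zeroʳ (x * y)

triple-vanish : ∀ {x y z : ℚ} {o0 o1 o2 : Bool} → (o0 ≡ false → x ≡ 0ℚ) → (o1 ≡ false → y ≡ 0ℚ) → (o2 ≡ false → z ≡ 0ℚ) →
  (o0 ∧ (o1 ∧ o2)) ≡ false → x * y * z ≡ 0ℚ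
triple-vanish {x} {y} {z} {false}               h0 h1 h2 _ = product-zero₀ y z (h0 refl)
triple-vanish {x} {y} {z} {true}  {false}       h0 h1 h2 _ = product-zero₁ x z (h1 refl)
triple-vanish {x} {y} {z} {true}  {true} {false} h0 h1 h2 _ = product-zero₂ x y (h2 refl)

module ReducedRecurrences (a b c : ℚ) where
  open Reduced a b c
  open Vanishing a b c

  -- whether the copy y is left with an odd number of used loops (corners covered from outside)
  oddCopy : (z0 z1 z2 βa βb βc : Bool) → Letter → Bool
  oddCopy z0 z1 z2 βa βb βc y = odd (ind (copyZ0 z0 βc y) ℕ.+ (ind (copyZ1 z1 βb y) ℕ.+ ind (copyZ2 z2 βa y)))

  T-vanish : ∀ m z0 z1 z2 βa βb βc →
    (oddCopy z0 z1 z2 βa βb βc l0 ∧ (oddCopy z0 z1 z2 βa βb βc l1 ∧ oddCopy z0 z1 z2 βa βb βc l2)) ≡ false →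
    T z0 z1 z2 βa βb βc (suc m) ≡ 0ℚ
  T-vanish m z0 z1 z2 βa βb βc = triple-vanish (even l0) (even l1) (even l2)
    where
    even : ∀ y → oddCopy z0 z1 z2 βa βb βc y ≡ false → F (copyZ0 z0 βc y) (copyZ1 z1 βb y) (copyZ2 z2 βa y) (suc m) ≡ 0ℚ
    even y = F-even m (copyZ0 z0 βc y) (copyZ1 z1 βb y) (copyZ2 z2 βa y)

  -- the recurrences of the reduced partition functions, X = F(all loops), Yk = F(loop at k^n only)
  module _ (m : ℕ) where
    private
      X Y0 Y1 Y2 : ℚ
      X  = F true  true  true  (suc m)
      Y0 = F true  false false (suc m)
      Y1 = F false true  false (suc m)
      Y2 = F false false true  (suc m)

      T′ : (z0 z1 z2 βa βb βc : Bool) → ℚ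
      T′ z0 z1 z2 βa βb βc = T z0 z1 z2 βa βb βc (suc m)

      vanish : ∀ z0 z1 z2 βa βb βc →
        (oddCopy z0 z1 z2 βa βb βc l0 ∧ (oddCopy z0 z1 z2 βa βb βc l1 ∧ oddCopy z0 z1 z2 βa βb βc l2)) ≡ false →
        T′ z0 z1 z2 βa βb βc ≡ 0ℚ
      vanish = T-vanish m

      pairs : (Bool → Bool → Bool → ℚ) → ℚ
      pairs g = (a * b * c * g true true true + g false false false) + ((a * b * g true true false + c * g false false true) +
                ((a * c * g true false true + b * g false true false) + (b * c * g false true true + a * g true false false)))

      expand : ∀ z0 z1 z2 → F z0 z1 z2 (suc (suc m)) ≡ pairs (T′ z0 z1 z2)
      expand z0 z1 z2 = ≡-trans (F-suc m z0 z1 z2) (bridgeSum-pairs a b c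
        (T′ z0 z1 z2 true true true) (T′ z0 z1 z2 true true false) (T′ z0 z1 z2 true false true) (T′ z0 z1 z2 true false false)
        (T′ z0 z1 z2 false true true) (T′ z0 z1 z2 false true false) (T′ z0 z1 z2 false false true) (T′ z0 z1 z2 false false false))

    F-rec-I : F true true true (suc (suc m)) ≡ a * b * c * (X * X * X) + Y0 * Y1 * Y2
    F-rec-I = ≡-trans (expand true true true) (only-1st
      (pair-zero (a * b) c (vanish true true true true true false refl) (vanish true true true false false true refl))
      (pair-zero (a * c) b (vanish true true true true false true refl) (vanish true true true false true false refl))
      (pair-zero (b * c) a (vanish true true true false true true refl) (vanish true true true true false false refl)))

    F-rec-II : F true false false (suc (suc m)) ≡ a * b * (X * Y2 * Y1) + c * (Y0 * Y0 * Y0)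
    F-rec-II = ≡-trans (expand true false false) (only-2nd
      (pair-zero′ (a * b * c) (vanish true false false true true true refl) (vanish true false false false false false refl))
      (pair-zero (a * c) b (vanish true false false true false true refl) (vanish true false false false true false refl))
      (pair-zero (b * c) a (vanish true false false false true true refl) (vanish true false false true false false refl)))

    F-rec-III : F false true false (suc (suc m)) ≡ a * c * (Y2 * X * Y0) + b * (Y1 * Y1 * Y1)
    F-rec-III = ≡-trans (expand false true false) (only-3rd
      (pair-zero′ (a * b * c) (vanish false true false true true true refl) (vanish false true false false false false refl))
      (pair-zero (a * b) c (vanish false true false true true false refl) (vanish false true false false false true refl))
      (pair-zero (b * c) a (vanish false true false false true true refl) (vanish false true false true false false refl)))

    F-rec-IV : F false false true (suc (suc m)) ≡ b * c * (Y1 * Y0 * X) + a * (Y2 * Y2 * Y2)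
    F-rec-IV = ≡-trans (expand false false true) (only-4th
      (pair-zero′ (a * b * c) (vanish false false true true true true refl) (vanish false false true false false false refl))
      (pair-zero (a * b) c (vanish false false true true true false refl) (vanish false false true false false true refl))
      (pair-zero (a * c) b (vanish false false true true false true refl) (vanish false false true false true false refl)))

drop-units : ∀ {k k'} P Q → k ≡ 1ℚ → k' ≡ 1ℚ → k * P + k' * Q ≡ P + Q
drop-units P Q refl refl = cong₂ _+_ (*-identityˡ P) (*-identityˡ Q)

-- the recurrences for Φ, obtained from those for F by multiplying with the loop weights
module Cancellation (a b c ia ib ic X Y0 Y1 Y2 : ℚ) (ua : a * ia ≡ 1ℚ) (ub : b * ib ≡ 1ℚ) (uc : c * ic ≡ 1ℚ) where

  alg-I : a * (b * (c * (a * b * c * (X * X * X) + Y0 * Y1 * Y2))) ≡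
    a * (b * (c * X)) * (a * (b * (c * X))) * (a * (b * (c * X))) * ia * ib * ic + c * Y0 * (b * Y1) * (a * Y2)
  alg-I = ≡-trans (lhs a b c X Y0 Y1 Y2) (≡-trans (sym (drop-units P Q (cong₂ _*_ (cong₂ _*_ ua ub) uc) refl))
                  (rhs a b c ia ib ic X Y0 Y1 Y2))
    where
    P : ℚ
    P = a * b * c * (a * b * c) * (X * X * X)
    Q : ℚ
    Q = a * b * c * (Y0 * Y1 * Y2)
    lhs : ∀ a b c X Y0 Y1 Y2 → a * (b * (c * (a * b * c * (X * X * X) + Y0 * Y1 * Y2))) ≡
      a * b * c * (a * b * c) * (X * X * X) + a * b * c * (Y0 * Y1 * Y2)
    lhs = solve-∀ ℚ-ring
    rhs : ∀ a b c ia ib ic X Y0 Y1 Y2 →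
      a * ia * (b * ib) * (c * ic) * (a * b * c * (a * b * c) * (X * X * X)) + 1ℚ * (a * b * c * (Y0 * Y1 * Y2)) ≡
      a * (b * (c * X)) * (a * (b * (c * X))) * (a * (b * (c * X))) * ia * ib * ic + c * Y0 * (b * Y1) * (a * Y2)
    rhs = solve-∀ ℚ-ring

  alg-II : c * (a * b * (X * Y2 * Y1) + c * (Y0 * Y0 * Y0)) ≡
    c * Y0 * (c * Y0) * (c * Y0) * ic + a * (b * (c * X)) * (b * Y1) * (a * Y2) * ia * ib
  alg-II = ≡-trans (lhs a b c X Y0 Y1 Y2) (≡-trans (sym (drop-units P Q uc (cong₂ _*_ ua ub)))
                   (rhs a b c ia ib ic X Y0 Y1 Y2))
    where
    P : ℚ
    P = c * c * (Y0 * Y0 * Y0)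
    Q : ℚ
    Q = a * b * c * (X * Y1 * Y2)
    lhs : ∀ a b c X Y0 Y1 Y2 → c * (a * b * (X * Y2 * Y1) + c * (Y0 * Y0 * Y0)) ≡
      c * c * (Y0 * Y0 * Y0) + a * b * c * (X * Y1 * Y2)
    lhs = solve-∀ ℚ-ring
    rhs : ∀ a b c ia ib ic X Y0 Y1 Y2 →
      c * ic * (c * c * (Y0 * Y0 * Y0)) + a * ia * (b * ib) * (a * b * c * (X * Y1 * Y2)) ≡
      c * Y0 * (c * Y0) * (c * Y0) * ic + a * (b * (c * X)) * (b * Y1) * (a * Y2) * ia * ib
    rhs = solve-∀ ℚ-ring

  alg-III : b * (a * c * (Y2 * X * Y0) + b * (Y1 * Y1 * Y1)) ≡
    b * Y1 * (b * Y1) * (b * Y1) * ib + a * (b * (c * X)) * (c * Y0) * (a * Y2) * ia * ic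
  alg-III = ≡-trans (lhs a b c X Y0 Y1 Y2) (≡-trans (sym (drop-units P Q ub (cong₂ _*_ ua uc)))
                    (rhs a b c ia ib ic X Y0 Y1 Y2))
    where
    P : ℚ
    P = b * b * (Y1 * Y1 * Y1)
    Q : ℚ
    Q = a * b * c * (X * Y0 * Y2)
    lhs : ∀ a b c X Y0 Y1 Y2 → b * (a * c * (Y2 * X * Y0) + b * (Y1 * Y1 * Y1)) ≡
      b * b * (Y1 * Y1 * Y1) + a * b * c * (X * Y0 * Y2)
    lhs = solve-∀ ℚ-ring
    rhs : ∀ a b c ia ib ic X Y0 Y1 Y2 →
      b * ib * (b * b * (Y1 * Y1 * Y1)) + a * ia * (c * ic) * (a * b * c * (X * Y0 * Y2)) ≡
      b * Y1 * (b * Y1) * (b * Y1) * ib + a * (b * (c * X)) * (c * Y0) * (a * Y2) * ia * ic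
    rhs = solve-∀ ℚ-ring

  alg-IV : a * (b * c * (Y1 * Y0 * X) + a * (Y2 * Y2 * Y2)) ≡
    a * Y2 * (a * Y2) * (a * Y2) * ia + a * (b * (c * X)) * (c * Y0) * (b * Y1) * ib * ic
  alg-IV = ≡-trans (lhs a b c X Y0 Y1 Y2) (≡-trans (sym (drop-units P Q ua (cong₂ _*_ ub uc)))
                   (rhs a b c ia ib ic X Y0 Y1 Y2))
    where
    P : ℚ
    P = a * a * (Y2 * Y2 * Y2)
    Q : ℚ
    Q = a * b * c * (X * Y0 * Y1)
    lhs : ∀ a b c X Y0 Y1 Y2 → a * (b * c * (Y1 * Y0 * X) + a * (Y2 * Y2 * Y2)) ≡
      a * a * (Y2 * Y2 * Y2) + a * b * c * (X * Y0 * Y1)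
    lhs = solve-∀ ℚ-ring
    rhs : ∀ a b c ia ib ic X Y0 Y1 Y2 →
      a * ia * (a * a * (Y2 * Y2 * Y2)) + b * ib * (c * ic) * (a * b * c * (X * Y0 * Y1)) ≡
      a * Y2 * (a * Y2) * (a * Y2) * ia + a * (b * (c * X)) * (c * Y0) * (b * Y1) * ib * ic
    rhs = solve-∀ ℚ-ring

cong₄ : ∀ {A B : Set} (f : A → A → A → A → B) {p p' q q' r r' s s'} →
  p ≡ p' → q ≡ q' → r ≡ r' → s ≡ s' → f p q r s ≡ f p' q' r' s'
cong₄ f refl refl refl refl = refl

module MainRecurrences (a b c : ℚ) (ha : a > 0ℚ) (hb : b > 0ℚ) (hc : c > 0ℚ) where
  open Reduced a b c using (F)
  open Loops a b c using (Φ-I; Φ-II; Φ-III; Φ-IV)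
  open ReducedRecurrences a b c using (F-rec-I; F-rec-II; F-rec-III; F-rec-IV)

  module _ (m : ℕ) where
    open Cancellation a b c (inv a ha) (inv b hb) (inv c hc) (F true true true (suc m)) (F true false false (suc m))
      (F false true false (suc m)) (F false false true (suc m))
      (*-inverseʳ a {{>-nonZero ha}}) (*-inverseʳ b {{>-nonZero hb}}) (*-inverseʳ c {{>-nonZero hc}})

    recurrence-I : Φ I a b c (suc (suc m)) ≡
      Φ I a b c (suc m) * Φ I a b c (suc m) * Φ I a b c (suc m) * inv a ha * inv b hb * inv c hc
      + Φ II a b c (suc m) * Φ III a b c (suc m) * Φ IV a b c (suc m)
    recurrence-I = ≡-trans (Φ-I (suc m)) (≡-trans (cong (λ t → a * (b * (c * t))) (F-rec-I m)) (≡-trans alg-I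
      (sym (cong₄ (λ p q r s → p * p * p * inv a ha * inv b hb * inv c hc + q * r * s) (Φ-I m) (Φ-II m) (Φ-III m) (Φ-IV m)))))

    recurrence-II : Φ II a b c (suc (suc m)) ≡
      Φ II a b c (suc m) * Φ II a b c (suc m) * Φ II a b c (suc m) * inv c hc
      + Φ I a b c (suc m) * Φ III a b c (suc m) * Φ IV a b c (suc m) * inv a ha * inv b hb
    recurrence-II = ≡-trans (Φ-II (suc m)) (≡-trans (cong (c *_) (F-rec-II m)) (≡-trans alg-II
      (sym (cong₄ (λ p q r s → q * q * q * inv c hc + p * r * s * inv a ha * inv b hb) (Φ-I m) (Φ-II m) (Φ-III m) (Φ-IV m)))))

    recurrence-III : Φ III a b c (suc (suc m)) ≡
      Φ III a b c (suc m) * Φ III a b c (suc m) * Φ III a b c (suc m) * inv b hb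
      + Φ I a b c (suc m) * Φ II a b c (suc m) * Φ IV a b c (suc m) * inv a ha * inv c hc
    recurrence-III = ≡-trans (Φ-III (suc m)) (≡-trans (cong (b *_) (F-rec-III m)) (≡-trans alg-III
      (sym (cong₄ (λ p q r s → r * r * r * inv b hb + p * q * s * inv a ha * inv c hc) (Φ-I m) (Φ-II m) (Φ-III m) (Φ-IV m)))))

    recurrence-IV : Φ IV a b c (suc (suc m)) ≡
      Φ IV a b c (suc m) * Φ IV a b c (suc m) * Φ IV a b c (suc m) * inv a ha
      + Φ I a b c (suc m) * Φ II a b c (suc m) * Φ III a b c (suc m) * inv b hb * inv c hc
    recurrence-IV = ≡-trans (Φ-IV (suc m)) (≡-trans (cong (a *_) (F-rec-IV m)) (≡-trans alg-IV
      (sym (cong₄ (λ p q r s → s * s * s * inv a ha + p * q * r * inv b hb * inv c hc) (Φ-I m) (Φ-II m) (Φ-III m) (Φ-IV m)))))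

-- Σ_1 is a triangle with a loop at each vertex; its partition functions are evaluated directly
module Initial (a b c : ℚ) where
  Φ₁-I : Φ I a b c 1 ≡ a * b * c
  Φ₁-I = ≡-trans (+-identityʳ _) (≡-trans (cong (λ t → a * (b * t)) (*-identityʳ c)) (sym (*-assoc a b c)))

  Φ₁-II : Φ II a b c 1 ≡ c * c
  Φ₁-II = ≡-trans (+-identityʳ _) (cong (c *_) (*-identityʳ c))

  Φ₁-III : Φ III a b c 1 ≡ b * b
  Φ₁-III = ≡-trans (+-identityʳ _) (cong (b *_) (*-identityʳ b))

  Φ₁-IV : Φ IV a b c 1 ≡ a * a
  Φ₁-IV = ≡-trans (+-identityʳ _) (cong (a *_) (*-identityʳ a))

theorem3p1 : (a b c : ℚ) (ha : a > 0ℚ) (hb : b > 0ℚ) (hc : c > 0ℚ) →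
    ((n : ℕ) → 1 ℕ.≤ n →
      (Φ I a b c (suc n) ≡ Φ I a b c n * Φ I a b c n * Φ I a b c n * inv a ha * inv b hb * inv c hc
                             + Φ II a b c n * Φ III a b c n * Φ IV a b c n)
      × (Φ II a b c (suc n) ≡ Φ II a b c n * Φ II a b c n * Φ II a b c n * inv c hc
                             + Φ I a b c n * Φ III a b c n * Φ IV a b c n * inv a ha * inv b hb)
      × (Φ III a b c (suc n) ≡ Φ III a b c n * Φ III a b c n * Φ III a b c n * inv b hb
                             + Φ I a b c n * Φ II a b c n * Φ IV a b c n * inv a ha * inv c hc)
      × (Φ IV a b c (suc n) ≡ Φ IV a b c n * Φ IV a b c n * Φ IV a b c n * inv a ha
                             + Φ I a b c n * Φ II a b c n * Φ III a b c n * inv b hb * inv c hc))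
    × (Φ I a b c 1 ≡ a * b * c)
    × (Φ II a b c 1 ≡ c * c)
    × (Φ III a b c 1 ≡ b * b)
    × (Φ IV a b c 1 ≡ a * a)
theorem3p1 a b c ha hb hc =
  (λ { (suc m) _ → recurrence-I m , recurrence-II m , recurrence-III m , recurrence-IV m }) ,
  Φ₁-I , Φ₁-II , Φ₁-III , Φ₁-IV
  where
  open MainRecurrences a b c ha hb hc
  open Initial a b c
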